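{- Let $n\ge 2$. For each $i\in\{1,\dots,n\}$ and each $k$ with $0\le k\le n-2$, the number of arithmetical $d$-structures $(d_1,\dots,d_n)$ on $\mathcal{P}_n$ with $d_i=n-k-1$ equals $B(n-2,k)$.
   Context: $\mathcal{P}_n$ is the path graph with vertices $1,\dots,n$ and edges $\{j,j+1\}$, with adjacency matrix $A$. An arithmetical structure on $\mathcal{P}_n$ is a pair $(\mathbf{d},\mathbf{r})$ of positive integer vectors in $\mathbb{Z}^n$ with $\mathbf{r}$ primitive (gcd of entries $1$) and $(\operatorname{diag}(\mathbf{d})-A)\mathbf{r}=\mathbf{0}$; $\mathbf{d}$ is called an arithmetical $d$-structure (it determines $\mathbf{r}$). For nonnegative integers $k,\ell$, the ballot number $B(k,\ell)$ is the number of lattice paths from $(0,0)$ to $(k,\ell)$ using unit east and north steps that never go above the line $y=x$. -}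

module Defs where

open import Data.Nat using (ℕ; zero; suc; _+_; _*_; _≤_)
open import Data.Nat.GCD using (gcd)
open import Data.Fin using (Fin; toℕ)
open import Data.Vec using (Vec; lookup; tabulate; foldr)
import Data.Vec as V
open import Data.List using (List; []; _∷_; map; _++_; filter; length)
open import Data.Bool using (Bool; true; false; _∧_)
open import Data.Product using (Σ; _×_)
open import Relation.Binary.PropositionalEquality using (_≡_)
open import Relation.Nullary using (Dec; yes; no)
open import Data.Nat using (_≟_)
open import Data.Nat using (_≤ᵇ_)

-- Adjacency matrix of the path graph P_n on vertices 0,…,n-1 (0-indexed
-- version of 1,…,n): A i j = 1 iff |i - j| = 1.
adjP : (n : ℕ) → Fin n → Fin n → ℕ
adjP n i j with toℕ j ≟ suc (toℕ i) | toℕ i ≟ suc (toℕ j)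
... | yes _ | _     = 1
... | no _  | yes _ = 1
... | no _  | no _  = 0

adjApply : (n : ℕ) → Vec ℕ n → Fin n → ℕ
adjApply n r i = V.sum (tabulate (λ j → adjP n i j * lookup r j))

gcdVec : {n : ℕ} → Vec ℕ n → ℕ
gcdVec = foldr _ gcd 0

IsArithStruct : (n : ℕ) → Vec ℕ n → Vec ℕ n → Set
IsArithStruct n d r =
  ((i : Fin n) → 1 ≤ lookup d i) ×
  ((i : Fin n) → 1 ≤ lookup r i) ×
  (gcdVec r ≡ 1) ×
  ((i : Fin n) → lookup d i * lookup r i ≡ adjApply n r i)

IsArithD : (n : ℕ) → Vec ℕ n → Set
IsArithD n d = Σ (Vec ℕ n) (λ r → IsArithStruct n d r)

data Step : Set where
  E N : Step

paths : ℕ → ℕ → List (List Step)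
paths zero    zero    = [] ∷ []
paths (suc k) zero    = map (E ∷_) (paths k zero)
paths zero    (suc l) = map (N ∷_) (paths zero l)
paths (suc k) (suc l) = map (E ∷_) (paths k (suc l)) ++ map (N ∷_) (paths (suc k) l)

neverAbove : ℕ → ℕ → List Step → Bool
neverAbove x y []       = y ≤ᵇ x
neverAbove x y (E ∷ s)  = (y ≤ᵇ x) ∧ neverAbove (suc x) y s
neverAbove x y (N ∷ s)  = (y ≤ᵇ x) ∧ neverAbove x (suc y) s

ballot : ℕ → ℕ → ℕ
ballot k l = length (filter (λ p → neverAbove 0 0 p Data.Bool.≟ true) (paths k l))

-- An arithmetical structure d(1) … d(n) on the path is the list of triangle counts at the vertices
-- 1, …, n of a triangulated polygon with vertices 0, 1, …, n (Conway–Coxeter); the count at vertex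
-- 0, closing d, is read off the second solution of the recurrence r(j-1) + r(j+1) = d(j) r(j).
-- Rotating the polygon permutes the structures and moves vertex 0 to any position i, so it suffices
-- to count structures with closing d = n - k - 1. Every structure with n ≥ 2 vertices is uniquely
-- glue (addEar e) R: an ear on the edge (0 , 1) of the polygon of e, glued along a diagonal through
-- vertex 0 to the polygon of R. Sending it to glue (rotate e) R is a bijection from the structures
-- on n vertices with closing v + 1 onto those on n - 1 vertices with closing at least v, and this
-- sum over closing values is the last-step recursion B(m+1,k+1) = B(m,k+1) + B(m+1,k).

module Submission where

open import Defs
open import Data.Nat using (ℕ; suc; _∸_; _≤_)
open import Data.Fin using (Fin)
open import Data.Vec using (Vec; lookup)
open import Data.List using (List; length)
open import Data.List.Membership.Propositional using (_∈_)
open import Data.List.Relation.Unary.Unique.Propositional using (Unique)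
open import Data.Product using (Σ; _×_)
open import Function.Bundles using (_⇔_)
open import Relation.Binary.PropositionalEquality using (_≡_)

open import Data.Bool using (Bool; true; false; if_then_else_; _∧_)
import Data.Bool as Bool
open import Data.Empty using (⊥; ⊥-elim)
open import Data.Fin using (toℕ; fromℕ<; zero; suc)
open import Data.Fin.Properties using (toℕ<n; toℕ-fromℕ<)
open import Data.List using ([]; _∷_; _++_; [_]; reverse; map; filter)
open import Data.List.Membership.Propositional.Properties using (∈-map⁺; ∈-map⁻; ∈-++⁺ˡ; ∈-++⁺ʳ; ∈-++⁻)
open import Data.List.Properties
  using (∷-injective; map-++; map-∘; length-map; unfold-reverse; reverse-++; reverse-involutive; length-++; length-reverse)
open import Data.List.Relation.Unary.All using (All; []; _∷_)
import Data.List.Relation.Unary.All as All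
import Data.List.Relation.Unary.All.Properties as AllP
open import Data.List.Relation.Unary.AllPairs using ([]; _∷_)
open import Data.List.Relation.Unary.Any using (here)
import Data.List.Relation.Unary.Unique.Propositional.Properties as UniqueP
open import Data.Nat using (zero; _+_; _*_; _<_; z≤n; s≤s; _≡ᵇ_; _≤ᵇ_)
open import Data.Nat.Divisibility using (_∣_; _∣0; ∣n⇒∣m*n; ∣m+n∣m⇒∣n; ∣1⇒≡1; ∣-refl)
open import Data.Nat.GCD using (gcd-greatest; gcd-zeroˡ)
open import Data.Nat.Properties
open import Data.Nat.Tactic.RingSolver using (solve-∀)
open import Data.Product using (∃; _,_; proj₁; proj₂)
open import Data.Sum using (inj₁; inj₂)
open import Data.Unit using (⊤)
open import Data.Vec using (tabulate; toList; []; _∷_)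
import Data.Vec as V
open import Data.Vec.Properties using (tabulate-cong; lookup∘tabulate; tabulate∘lookup; length-toList)
open import Function using (_∘_)
open import Function.Bundles using (mk⇔)
open import Relation.Binary.PropositionalEquality
  using (_≢_; refl; sym; trans; cong; cong₂; subst; subst₂; module ≡-Reasoning)
open import Relation.Nullary using (¬_; yes; no)


≡+⇒∸≡ : ∀ {m} a c → m ≡ a + c → m ∸ a ≡ c
≡+⇒∸≡ a c refl = m+n∸m≡n a c

at : List ℕ → ℕ → ℕ
at []       _       = 0
at (x ∷ xs) zero    = x
at (x ∷ xs) (suc j) = at xs j

at-++ˡ : ∀ (xs ys : List ℕ) {j} → j < length xs → at (xs ++ ys) j ≡ at xs j
at-++ˡ (x ∷ xs) ys {zero}  _         = refl
at-++ˡ (x ∷ xs) ys {suc j} (s≤s j<n) = at-++ˡ xs ys j<n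

at-++-length : ∀ (xs : List ℕ) y ys → at (xs ++ y ∷ ys) (length xs) ≡ y
at-++-length []       y ys = refl
at-++-length (x ∷ xs) y ys = at-++-length xs y ys

All-at : ∀ {P : ℕ → Set} {xs} → All P xs → ∀ {j} → j < length xs → P (at xs j)
All-at (p ∷ ps) {zero}  _         = p
All-at (p ∷ ps) {suc j} (s≤s j<n) = All-at ps j<n

++-injective-length : ∀ (xs ys : List ℕ) {zs ws} → length xs ≡ length ys →
                      xs ++ zs ≡ ys ++ ws → xs ≡ ys × zs ≡ ws
++-injective-length []       []       _ eq = refl , eq
++-injective-length (x ∷ xs) (y ∷ ys) l eq with ∷-injective eq
... | refl , eq' with ++-injective-length xs ys (suc-injective l) eq'
... | refl , eq'' = refl , eq''

firstOne : List ℕ → ℕ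
firstOne []       = 0
firstOne (x ∷ xs) = if x ≡ᵇ 1 then 0 else suc (firstOne xs)

firstOne-++ : ∀ {xs} ys → All (2 ≤_) xs → firstOne (xs ++ 1 ∷ ys) ≡ length xs
firstOne-++ ys []                      = refl
firstOne-++ ys (s≤s (s≤s z≤n) ∷ x≥2s) = cong suc (firstOne-++ ys x≥2s)

between : {A : Set} → (ℕ → List A) → ℕ → ℕ → List A
between F zero    v = []
between F (suc f) v = F v ++ between F f (suc v)

∈-between⁻ : ∀ {A : Set} (F : ℕ → List A) f v {x} → x ∈ between F f v →
             ∃ λ u → v ≤ u × u < v + f × x ∈ F u
∈-between⁻ F (suc f) v x∈ with ∈-++⁻ (F v) x∈
... | inj₁ x∈F = v , ≤-refl , m<m+n v (s≤s z≤n) , x∈F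
... | inj₂ x∈B with ∈-between⁻ F f (suc v) x∈B
...   | u , v<u , u<1+v+f , x∈F = u , <⇒≤ v<u , subst (u <_) (sym (+-suc v f)) u<1+v+f , x∈F

∈-between⁺ : ∀ {A : Set} (F : ℕ → List A) f v {u x} → v ≤ u → u < v + f → x ∈ F u → x ∈ between F f v
∈-between⁺ F zero    v {u} v≤u u<v+0 _ = ⊥-elim (<⇒≱ (subst (u <_) (+-identityʳ v) u<v+0) v≤u)
∈-between⁺ F (suc f) v {u} v≤u u<v+f x∈ with m≤n⇒m<n∨m≡n v≤u
... | inj₂ refl = ∈-++⁺ˡ x∈
... | inj₁ v<u  = ∈-++⁺ʳ (F v) (∈-between⁺ F f (suc v) v<u (subst (u <_) (+-suc v f) u<v+f) x∈)

unique-map-reflect : ∀ {A B C : Set} (g : A → B) (h : A → C) (P : A → Set) xs → All P xs →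
                     (∀ {x y} → P x → P y → h x ≡ h y → g x ≡ g y) → Unique (map g xs) → Unique (map h xs)
unique-map-reflect g h P []       []         reflects _            = []
unique-map-reflect g h P (x ∷ xs) (px ∷ pxs) reflects (gx∉ ∷ uniq) =
  AllP.map⁺ (All.zipWith (λ (gx≢ , py) hx≡ → gx≢ (reflects px py hx≡)) (AllP.map⁻ gx∉ , pxs))
  ∷ unique-map-reflect g h P xs pxs reflects uniq

unique-between : ∀ {A B : Set} (F : ℕ → List A) (g : A → B) (level : B → ℕ) →
                 (∀ u → Unique (map g (F u))) → (∀ u {x} → x ∈ F u → level (g x) ≡ u) →
                 ∀ f v → Unique (map g (between F f v))
unique-between F g level uniq level≡ zero    v = []
unique-between F g level uniq level≡ (suc f) v =
  subst Unique (sym (map-++ g (F v) (between F f (suc v))))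
        (UniqueP.++⁺ (uniq v) (unique-between F g level uniq level≡ f (suc v)) disjoint)
  where
  disjoint : ∀ {y} → ¬ (y ∈ map g (F v) × y ∈ map g (between F f (suc v)))
  disjoint (y∈₁ , y∈₂) with ∈-map⁻ g y∈₁ | ∈-map⁻ g y∈₂
  ... | x₁ , x₁∈ , refl | x₂ , x₂∈ , y≡ with ∈-between⁻ F f (suc v) x₂∈
  ...   | u , v<u , _ , x₂∈F = <⇒≢ v<u (trans (sym (level≡ v x₁∈)) (trans (cong level y≡) (level≡ u x₂∈F)))

-- Chains of the recurrence

-- Chain a b ds y z: a solution of r(j-1) + r(j+1) = x(j) * r(j) along ds = x(1) … x(m),
-- with (r(0) , r(1)) = (a , b) and (r(m) , r(m+1)) = (y , z).
data Chain : ℕ → ℕ → List ℕ → ℕ → ℕ → Set where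
  nil  : ∀ {a b} → Chain a b [] a b
  cons : ∀ {a b c x ds y z} → x * b ≡ a + c → Chain b c ds y z → Chain a b (x ∷ ds) y z

run : ℕ → ℕ → List ℕ → ℕ × ℕ
run a b []       = a , b
run a b (x ∷ ds) = run b (x * b ∸ a) ds

values : ℕ → ℕ → List ℕ → List ℕ
values a b []       = []
values a b (x ∷ ds) = b ∷ values b (x * b ∸ a) ds

length-values : ∀ a b ds → length (values a b ds) ≡ length ds
length-values a b []       = refl
length-values a b (x ∷ ds) = cong suc (length-values b (x * b ∸ a) ds)

values-cons : ∀ {a b c x ds} → x * b ≡ a + c → values a b (x ∷ ds) ≡ b ∷ values b c ds
values-cons {a} {b} {c} e rewrite ≡+⇒∸≡ a c e = refl

run-chain : ∀ {a b ds y z} → Chain a b ds y z → run a b ds ≡ (y , z)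
run-chain nil          = refl
run-chain (cons {a = a} {c = c} e ch) rewrite ≡+⇒∸≡ a c e = run-chain ch

chain-cast : ∀ {a b ds y z a' b' y' z'} → a ≡ a' → b ≡ b' → y ≡ y' → z ≡ z' →
             Chain a b ds y z → Chain a' b' ds y' z'
chain-cast refl refl refl refl ch = ch

chain-snoc : ∀ {a b ds y z x w} → Chain a b ds y z → x * z ≡ y + w → Chain a b (ds ++ [ x ]) z w
chain-snoc nil         e' = cons e' nil
chain-snoc (cons e ch) e' = cons e (chain-snoc ch e')

chain-reverse : ∀ {a b ds y z} → Chain a b ds y z → Chain z y (reverse ds) b a
chain-reverse nil = nil
chain-reverse {a} (cons {c = c} {x} {ds} e ch) rewrite unfold-reverse x ds =
  chain-snoc (chain-reverse ch) (trans e (+-comm a c))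

step-+ : ∀ {x a b c a' b' c'} → x * b ≡ a + c → x * b' ≡ a' + c' → x * (b + b') ≡ (a + a') + (c + c')
step-+ {x} {a} {b} {c} {a'} {b'} {c'} e e' =
  trans (*-distribˡ-+ x b b') (trans (cong₂ _+_ e e') (+-interchange a c a' c'))
  where
  +-interchange : ∀ p q s t → (p + q) + (s + t) ≡ (p + s) + (q + t)
  +-interchange = solve-∀

chain-+ : ∀ {a b ds y z a' b' y' z'} → Chain a b ds y z → Chain a' b' ds y' z' →
          Chain (a + a') (b + b') ds (y + y') (z + z')
chain-+ nil         nil           = nil
chain-+ (cons {a} {b} {c} {x} e ch) (cons {a'} {b'} {c'} e' ch') =
  cons (step-+ {x} {a} {b} {c} {a'} {b'} {c'} e e') (chain-+ ch ch')

chain-scale : ∀ k {a b ds y z} → Chain a b ds y z → Chain (k * a) (k * b) ds (k * y) (k * z)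
chain-scale k nil = nil
chain-scale k {a} {b} (cons {c = c} {x} e ch) = cons (begin
    x * (k * b)   ≡⟨ rearrange x k b ⟩
    k * (x * b)   ≡⟨ cong (k *_) e ⟩
    k * (a + c)   ≡⟨ *-distribˡ-+ k a c ⟩
    k * a + k * c ∎) (chain-scale k ch)
  where
  open ≡-Reasoning
  rearrange : ∀ p q s → p * (q * s) ≡ q * (p * s)
  rearrange = solve-∀

chain-from-zeros : ∀ {ds y z} → Chain 0 0 ds y z → y ≡ 0 × z ≡ 0
chain-from-zeros nil = refl , refl
chain-from-zeros {x ∷ _} (cons {c = zero}  e ch) = chain-from-zeros ch
chain-from-zeros {x ∷ _} (cons {c = suc c} e ch) = ⊥-elim (0≢1+n (trans (sym (*-zeroʳ x)) e))

-- The 2×2 determinant of two solutions of the same recurrence is constant along the chain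
-- (written with both sides moved so that no subtraction occurs).
chain-det : ∀ {a b ds y z a' b' y' z'} → Chain a b ds y z → Chain a' b' ds y' z' →
            a * b' + z * y' ≡ b * a' + y * z'
chain-det {a} {b} {a' = a'} {b'} nil nil = +-comm (a * b') (b * a')
chain-det {a} {b} {y = y} {z} {a'} {b'} {y'} {z'} (cons {c = c} {x} e ch) (cons {c = c'} e' ch') =
  +-cancelʳ-≡ (b * c') _ _ (begin
    a * b' + z * y' + b * c'   ≡⟨ +-swap (a * b') (z * y') (b * c') ⟩
    a * b' + (b * c' + z * y') ≡⟨ cong (a * b' +_) (chain-det ch ch') ⟩
    a * b' + (c * b' + y * z') ≡⟨ factor a c b' (y * z') ⟩
    (a + c) * b' + y * z'      ≡⟨ cong (λ t → t * b' + y * z') (sym e) ⟩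
    x * b * b' + y * z'        ≡⟨ *-swap x b b' (y * z') ⟩
    b * (x * b') + y * z'      ≡⟨ cong (λ t → b * t + y * z') e' ⟩
    b * (a' + c') + y * z'     ≡⟨ expand b a' c' (y * z') ⟩
    b * a' + y * z' + b * c'   ∎)
  where
  open ≡-Reasoning
  +-swap : ∀ p q s → p + q + s ≡ p + (s + q)
  +-swap = solve-∀
  factor : ∀ p q s t → p * s + (q * s + t) ≡ (p + q) * s + t
  factor = solve-∀
  *-swap : ∀ p q s t → p * q * s + t ≡ q * (p * s) + t
  *-swap = solve-∀
  expand : ∀ p q s t → p * (q + s) + t ≡ p * q + t + p * s
  expand = solve-∀

companion-key : ∀ {a b c x a' b'} → x * b ≡ a + c → a * b' ≡ suc (b * a') →
                b * (x * b') ≡ suc (b * a' + c * b')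
companion-key {a} {b} {c} {x} {a'} {b'} e d = begin
  b * (x * b')          ≡⟨ rearrange b x b' ⟩
  (x * b) * b'          ≡⟨ cong (_* b') e ⟩
  (a + c) * b'          ≡⟨ *-distribʳ-+ b' a c ⟩
  a * b' + c * b'       ≡⟨ cong (_+ c * b') d ⟩
  suc (b * a' + c * b') ∎
  where
  open ≡-Reasoning
  rearrange : ∀ p q s → p * (q * s) ≡ (q * p) * s
  rearrange = solve-∀

det-step : ∀ {a b c x a' b' c'} → x * b ≡ a + c → x * b' ≡ a' + c' → a * b' ≡ suc (b * a') →
           b * c' ≡ suc (c * b')
det-step {a} {b} {c} {x} {a'} {b'} {c'} e e' d = +-cancelˡ-≡ (b * a') _ _ (begin
  b * a' + b * c'       ≡⟨ sym (*-distribˡ-+ b a' c') ⟩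
  b * (a' + c')         ≡⟨ cong (b *_) (sym e') ⟩
  b * (x * b')          ≡⟨ companion-key {a} {b} {c} {x} {a'} {b'} e d ⟩
  suc (b * a' + c * b') ≡⟨ sym (+-suc (b * a') (c * b')) ⟩
  b * a' + suc (c * b') ∎)
  where open ≡-Reasoning

companion-next : ∀ {a b c x a' b'} → x * b ≡ a + c → a * b' ≡ suc (b * a') → a' < x * b'
companion-next {a} {b} {c} {x} {a'} {b'} e d =
  *-cancelˡ-< b a' (x * b') (subst (b * a' <_) (sym (companion-key {a} {b} {c} {x} {a'} {b'} e d))
                                    (s≤s (m≤m+n (b * a') (c * b'))))

-- A second solution with determinant 1 against the first always stays in ℕ.
chain-companion : ∀ {a b ds y z a' b'} → Chain a b ds y z → a * b' ≡ suc (b * a') →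
                  ∃ λ y' → ∃ λ z' → Chain a' b' ds y' z'
chain-companion nil d = _ , _ , nil
chain-companion {a} {b} {a' = a'} {b'} (cons {c = c} {x} e ch) d =
  let e' : x * b' ≡ a' + (x * b' ∸ a')
      e' = sym (m+[n∸m]≡n (<⇒≤ (companion-next {a} {b} {c} {x} {a'} {b'} e d)))
      (y' , z' , ch') = chain-companion ch (det-step {a} {b} {c} {x} {a'} {b'} e e' d)
  in y' , z' , cons e' ch'

values-positive : ∀ {a b ds y z} → Chain a b ds y z → ¬ (y ≡ 0 × z ≡ 0) → All (1 ≤_) (values a b ds)
values-positive nil ne = []
values-positive {a} {zero} (cons {c = c} {x} e ch) ne
  with m+n≡0⇒m≡0 a (trans (sym e) (*-zeroʳ x)) | m+n≡0⇒n≡0 a (trans (sym e) (*-zeroʳ x))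
... | refl | refl = ⊥-elim (ne (chain-from-zeros ch))
values-positive {a} {suc b} (cons {c = c} {x} e ch) ne rewrite ≡+⇒∸≡ a c e =
  s≤s z≤n ∷ values-positive ch ne

companion-slack : ∀ {a a' b' b} → a' < a → a * b' ≡ suc (suc b * a') → a * b' + b ≤ a * suc b
companion-slack {a} {a'} {b'} {b} lt d = begin
  a * b' + b           ≡⟨ cong (_+ b) d ⟩
  suc (suc b * a') + b ≡⟨ rearrange b a' ⟩
  suc b * suc a'       ≤⟨ *-monoʳ-≤ (suc b) lt ⟩
  suc b * a            ≡⟨ *-comm (suc b) a ⟩
  a * suc b            ∎
  where
  open ≤-Reasoning
  rearrange : ∀ p q → suc (suc p * q) + p ≡ suc p * suc q
  rearrange = solve-∀

companion-≤ : ∀ {a a' b b'} → a' < a → a * b' ≡ suc (b * a') → 1 ≤ b → b' ≤ b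
companion-≤ {suc a} {a'} {suc b} {b'} lt d _ =
  *-cancelˡ-≤ (suc a) (≤-trans (m≤m+n (suc a * b') b) (companion-slack {suc a} {a'} {b'} {b} lt d))

companion-< : ∀ {a a' b b'} → a' < a → a * b' ≡ suc (b * a') → 2 ≤ b → b' < b
companion-< {suc a} {b = suc zero} _ _ (s≤s ())
companion-< {suc a} {a'} {suc (suc b)} {b'} lt d _ =
  *-cancelˡ-< (suc a) _ _ (≤-trans (subst (_≤ suc a * b' + suc b) (+-comm (suc a * b') 1)
                                          (+-monoʳ-≤ (suc a * b') (s≤s z≤n)))
                                   (companion-slack {suc a} {a'} {b'} {suc b} lt d))

-- Subtracting the companion stays in ℕ as long as the values of the first chain are at least 2.
chain-difference : ∀ {a b ds y z a' b' y' z'} → Chain a b ds y z → Chain a' b' ds y' z' →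
  a * b' ≡ suc (b * a') → a' < a → All (2 ≤_) (values a b ds) → 1 ≤ z → ∀ ua → ua + a' ≡ a →
  ∃ λ ub → ∃ λ uy → ∃ λ uz → ub + b' ≡ b × Chain ua ub ds uy uz × uy + y' ≡ y × uz + z' ≡ z
chain-difference {b = b} {b' = b'} nil nil d lt [] z≥1 ua ea =
  let b'≤b = companion-≤ lt d z≥1
  in b ∸ b' , ua , b ∸ b' , m∸n+n≡m b'≤b , nil , ea , m∸n+n≡m b'≤b
chain-difference {a} {b} {a' = a'} {b'} (cons {c = c} {x} e ch) (cons {c = c'} e' ch') d lt vs z≥1 ua ea
  with subst (All (2 ≤_)) (values-cons {a} {b} {c} {x} e) vs
... | b≥2 ∷ rest =
  let b'<b = companion-< lt d b≥2
      eb : b ∸ b' + b' ≡ b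
      eb = m∸n+n≡m (<⇒≤ b'<b)
      (uc , uy , uz , ec , ch-u , ey , ez) =
        chain-difference ch ch' (det-step {a} {b} {c} {x} {a'} {b'} {c'} e e' d) b'<b rest z≥1 (b ∸ b') eb
      ex : x * (b ∸ b') ≡ ua + uc
      ex = +-cancelʳ-≡ (x * b') _ _ (begin
        x * (b ∸ b') + x * b' ≡⟨ sym (*-distribˡ-+ x (b ∸ b') b') ⟩
        x * (b ∸ b' + b')     ≡⟨ cong (x *_) eb ⟩
        x * b                 ≡⟨ e ⟩
        a + c                 ≡⟨ cong₂ _+_ (sym ea) (sym ec) ⟩
        (ua + a') + (uc + c') ≡⟨ +-interchange ua a' uc c' ⟩
        (ua + uc) + (a' + c') ≡⟨ cong ((ua + uc) +_) (sym e') ⟩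
        (ua + uc) + x * b'    ∎)
  in b ∸ b' , uy , uz , eb , cons ex ch-u , ey , ez
  where
  open ≡-Reasoning
  +-interchange : ∀ p q s t → (p + q) + (s + t) ≡ (p + s) + (q + t)
  +-interchange = solve-∀

values-++ : ∀ {a b ds y z} es → Chain a b ds y z → values a b (ds ++ es) ≡ values a b ds ++ values y z es
values-++ es nil = refl
values-++ es (cons {a = a} {b} {c} e ch) rewrite ≡+⇒∸≡ a c e = cong (b ∷_) (values-++ es ch)

values-+ : ∀ {a b ds y z a' b' y' z'} → Chain a b ds y z → Chain a' b' ds y' z' →
           All (1 ≤_) (values a b ds) → All (1 ≤_) (values a' b' ds) → All (2 ≤_) (values (a + a') (b + b') ds)
values-+ nil nil _ _ = []
values-+ (cons {a} {b} {c} {x} e ch) (cons {a'} {b'} {c'} e' ch') (p ∷ ps) (p' ∷ ps')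
  rewrite ≡+⇒∸≡ (a + a') (c + c') (step-+ {x} {a} {b} {c} {a'} {b'} {c'} e e')
        | ≡+⇒∸≡ a c e | ≡+⇒∸≡ a' c' e' =
  +-mono-≤ p p' ∷ values-+ ch ch' ps ps'

first-value-one : ∀ {a b ds} → Chain a b ds 1 0 → 2 ≤ b →
  ∃ λ mid → ∃ λ p → ∃ λ k → ∃ λ rest →
    ds ≡ mid ++ k ∷ rest × Chain a b mid p 1 × All (2 ≤_) (values a b mid) × Chain p 1 (k ∷ rest) 1 0
first-value-one (cons {c = zero} e nil) (s≤s ())
first-value-one {b = b} (cons {c = zero} e (cons {x = x} e' ch)) b≥2
  with trans (sym (*-zeroʳ x)) e'
first-value-one {b = suc (suc _)} (cons {c = zero} e (cons e' ch)) b≥2 | ()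
first-value-one (cons {c = suc zero} {x} e (cons {x = k} {ds = rest} e' ch)) b≥2 =
  x ∷ [] , _ , k , rest , refl , cons e nil , b≥2 ∷ [] , cons e' ch
first-value-one {a} {b} (cons {c = suc (suc c)} {x} e ch) b≥2 with first-value-one ch (s≤s (s≤s z≤n))
... | mid , p , k , rest , refl , ch-mid , mid≥2 , ch-rest =
  x ∷ mid , p , k , rest , refl , cons e ch-mid ,
  subst (All (2 ≤_)) (sym (values-cons {a} {b} {suc (suc c)} {x} e)) (b≥2 ∷ mid≥2) , ch-rest

chain-equations : ∀ {a b ds y} → Chain a b ds y 0 → ∀ j → j < length ds →
                  at ds j * at (values a b ds) j ≡ at (a ∷ values a b ds) j + at (values a b ds) (suc j)
chain-equations (cons e nil) zero _ = e
chain-equations (cons {a = a} {c = c} e (cons e' ch)) zero _ rewrite ≡+⇒∸≡ a c e = e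
chain-equations (cons {a = a} {c = c} e ch) (suc j) (s≤s j<n) rewrite ≡+⇒∸≡ a c e = chain-equations ch j j<n

equations-chain : ∀ ds ρ a → length ρ ≡ length ds →
  (∀ j → j < length ds → at ds j * at ρ j ≡ at (a ∷ ρ) j + at ρ (suc j)) →
  ∃ λ y → Chain a (at ρ 0) ds y 0 × values a (at ρ 0) ds ≡ ρ
equations-chain []       []      a _   _   = a , nil , refl
equations-chain (x ∷ ds) (b ∷ ρ) a len eqs =
  let y , ch , values≡ = equations-chain ds ρ b (suc-injective len) (λ j j<n → eqs (suc j) (s≤s j<n))
      e = eqs 0 (s≤s z≤n)
  in y , cons e ch , cong (b ∷_) (trans (cong (λ t → values b t ds) (≡+⇒∸≡ a (at ρ 0) e)) values≡)

chain-divides : ∀ {g a b ds y z} → Chain a b ds y z → g ∣ a → g ∣ b →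
                (∀ j → g ∣ at (values a b ds) j) × g ∣ y
chain-divides nil g∣a g∣b = (λ j → _ ∣0) , g∣a
chain-divides {g} {a} {b} (cons {c = c} {x} {ds} e ch) g∣a g∣b =
  let g∣values , g∣y = chain-divides ch g∣b (∣m+n∣m⇒∣n (subst (g ∣_) e (∣n⇒∣m*n x g∣b)) g∣a)
  in (λ { zero → g∣b ; (suc j) → subst (λ t → g ∣ at (values b t ds) j) (sym (≡+⇒∸≡ a c e)) (g∣values j) }) ,
     g∣y

chain-entries-positive : ∀ {a b ds y z} → Chain a b ds y z → 1 ≤ a → ¬ (y ≡ 0 × z ≡ 0) →
                         ∀ j → j < length ds → 1 ≤ at ds j
chain-entries-positive {a} (cons {x = zero} e ch) a≥1 _ zero _ =
  ⊥-elim (<⇒≱ a≥1 (≤-reflexive (m+n≡0⇒m≡0 a (sym e))))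
chain-entries-positive (cons {x = suc x} e ch) _ _ zero _ = s≤s z≤n
chain-entries-positive (cons {x = x} e ch) _ ne (suc j) (s≤s j<n) with values-positive (cons {x = x} e ch) ne
... | b≥1 ∷ _ = chain-entries-positive ch b≥1 ne j j<n

-- Structures, their closing value and rotation

-- d(1) … d(n) is an arithmetical d-structure whose r-vector has r(1) = r(n) = 1 (as all of them
-- do), read as a chain bordered by r(0) = r(n+1) = 0.
Arith : List ℕ → Set
Arith d = Chain 0 1 d 1 0

-- The second solution s with s(1) = 0, s(2) = 1 ends with (s(n) , s(n+1)) = (closing d , 1);
-- closing d is the number of triangles at the extra vertex 0 of the triangulated (n+1)-gon.
closing : List ℕ → ℕ
closing []       = 0
closing (x ∷ ds) = proj₁ (run 0 1 ds)

arith-head : ∀ {x ds} → Arith (x ∷ ds) → Chain 1 x ds 1 0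
arith-head {x} (cons e ch) = chain-cast refl (trans (sym e) (*-identityʳ x)) refl refl ch

closing-chain : ∀ {x ds} → Arith (x ∷ ds) → Chain 0 1 ds (closing (x ∷ ds)) 1
closing-chain {x} {ds} s =
  let ch = arith-head s
      (y' , z' , ch') = chain-companion {a' = 0} {b' = 1} ch (cong suc (sym (*-zeroʳ x)))
      z'≡1 : z' ≡ 1
      z'≡1 = sym (trans (chain-det ch ch') (trans (cong (_+ (z' + 0)) (*-zeroʳ x)) (+-identityʳ z')))
  in chain-cast refl refl (cong proj₁ (sym (run-chain ch'))) z'≡1 ch'

arith-nonempty : ∀ {d} → Arith d → ∃ λ x → ∃ λ ds → d ≡ x ∷ ds
arith-nonempty {x ∷ ds} _ = x , ds , refl

arith-singleton : ∀ {x} → Arith (x ∷ []) → x ≡ 0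
arith-singleton {x} (cons e nil) = trans (sym (*-identityʳ x)) e

arith-0 : Arith (0 ∷ [])
arith-0 = cons refl nil

arith-reverse : ∀ {d} → Arith d → Arith (reverse d)
arith-reverse = chain-reverse

arith-entries-positive : ∀ {d} → Arith d → 2 ≤ length d → ∀ j → j < length d → 1 ≤ at d j
arith-entries-positive {_ ∷ []}    s (s≤s ())
arith-entries-positive {x ∷ _ ∷ _} s _ zero    _ with values-positive (arith-head s) (λ { (() , _) })
... | x≥1 ∷ _ = x≥1
arith-entries-positive {x ∷ _ ∷ _} s _ (suc j) (s≤s j<n) =
  chain-entries-positive (arith-head s) (s≤s z≤n) (λ { (() , _) }) j j<n

rotate : List ℕ → List ℕ
rotate []       = []
rotate (x ∷ ds) = ds ++ [ closing (x ∷ ds) ]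

unrotate : List ℕ → List ℕ
unrotate d = reverse (rotate (reverse d))

arith-rotate : ∀ {d} → Arith d → Arith (rotate d)
arith-rotate {x ∷ ds} s = chain-snoc (closing-chain s) (trans (*-identityʳ _) (sym (+-identityʳ _)))

arith-unrotate : ∀ {d} → Arith d → Arith (unrotate d)
arith-unrotate s = arith-reverse (arith-rotate (arith-reverse s))

unrotate-rotate : ∀ {d} → Arith d → unrotate (rotate d) ≡ d
unrotate-rotate {x ∷ ds} s = begin
  reverse (rotate (reverse (ds ++ [ closing (x ∷ ds) ])))
    ≡⟨ cong (reverse ∘ rotate) (reverse-++ ds _) ⟩
  reverse (reverse ds ++ [ proj₁ (run 0 1 (reverse ds)) ])
    ≡⟨ cong (λ t → reverse (reverse ds ++ [ proj₁ t ])) (run-chain (chain-reverse (arith-head s))) ⟩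
  reverse (reverse ds ++ [ x ])
    ≡⟨ reverse-++ (reverse ds) [ x ] ⟩
  x ∷ reverse (reverse ds)
    ≡⟨ cong (x ∷_) (reverse-involutive ds) ⟩
  x ∷ ds ∎
  where open ≡-Reasoning

rotate-unrotate : ∀ {d} → Arith d → rotate (unrotate d) ≡ d
rotate-unrotate {d} s = begin
  rotate (unrotate d)                     ≡⟨ sym (reverse-involutive _) ⟩
  reverse (unrotate (rotate (reverse d))) ≡⟨ cong reverse (unrotate-rotate (arith-reverse s)) ⟩
  reverse (reverse d)                     ≡⟨ reverse-involutive d ⟩
  d                                       ∎
  where open ≡-Reasoning

length-rotate : ∀ d → length (rotate d) ≡ length d
length-rotate []       = refl
length-rotate (x ∷ ds) = trans (length-++ ds) (+-comm (length ds) 1)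

length-unrotate : ∀ d → length (unrotate d) ≡ length d
length-unrotate d = trans (length-reverse (rotate (reverse d))) (trans (length-rotate (reverse d)) (length-reverse d))

at-rotate : ∀ d {j} → suc j < length d → at (rotate d) j ≡ at d (suc j)
at-rotate (x ∷ ds) (s≤s j<n) = at-++ˡ ds _ j<n

rotate^ : ℕ → List ℕ → List ℕ
rotate^ zero    d = d
rotate^ (suc t) d = rotate^ t (rotate d)

unrotate^ : ℕ → List ℕ → List ℕ
unrotate^ zero    d = d
unrotate^ (suc t) d = unrotate (unrotate^ t d)

arith-rotate^ : ∀ t {d} → Arith d → Arith (rotate^ t d)
arith-rotate^ zero    s = s
arith-rotate^ (suc t) s = arith-rotate^ t (arith-rotate s)

arith-unrotate^ : ∀ t {d} → Arith d → Arith (unrotate^ t d)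
arith-unrotate^ zero    s = s
arith-unrotate^ (suc t) s = arith-unrotate (arith-unrotate^ t s)

length-rotate^ : ∀ t d → length (rotate^ t d) ≡ length d
length-rotate^ zero    d = refl
length-rotate^ (suc t) d = trans (length-rotate^ t (rotate d)) (length-rotate d)

rotate^-unrotate^ : ∀ t {d} → Arith d → rotate^ t (unrotate^ t d) ≡ d
rotate^-unrotate^ zero    s = refl
rotate^-unrotate^ (suc t) s = trans (cong (rotate^ t) (rotate-unrotate (arith-unrotate^ t s))) (rotate^-unrotate^ t s)

unrotate^-rotate^ : ∀ t {d} → Arith d → unrotate^ t (rotate^ t d) ≡ d
unrotate^-rotate^ zero    s = refl
unrotate^-rotate^ (suc t) s = trans (cong unrotate (unrotate^-rotate^ t (arith-rotate s))) (unrotate-rotate s)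

at-rotate^ : ∀ t d {j} → j + t < length d → at (rotate^ t d) j ≡ at d (j + t)
at-rotate^ zero    d {j} _ = cong (at d) (sym (+-identityʳ j))
at-rotate^ (suc t) d {j} j+1+t<n = begin
  at (rotate^ t (rotate d)) j ≡⟨ at-rotate^ t (rotate d) (subst (j + t <_) (sym (length-rotate d)) (<⇒≤ j+t+1<n)) ⟩
  at (rotate d) (j + t)       ≡⟨ at-rotate d j+t+1<n ⟩
  at d (suc (j + t))          ≡⟨ cong (at d) (sym (+-suc j t)) ⟩
  at d (j + suc t)            ∎
  where
  open ≡-Reasoning
  j+t+1<n : suc (j + t) < length d
  j+t+1<n = subst (_< length d) (+-suc j t) j+1+t<n

at-rotate^-closing : ∀ d {j} → j < length d → at (rotate^ (length d ∸ j) d) j ≡ closing d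
at-rotate^-closing (x ∷ ds) {j} (s≤s j≤m) = begin
  at (rotate^ (suc (length ds) ∸ j) (x ∷ ds)) j    ≡⟨ cong (λ t → at (rotate^ t (x ∷ ds)) j) (+-∸-assoc 1 j≤m) ⟩
  at (rotate^ (length ds ∸ j) (rotate (x ∷ ds))) j ≡⟨ at-rotate^ (length ds ∸ j) (rotate (x ∷ ds)) j+t<n ⟩
  at (rotate (x ∷ ds)) (j + (length ds ∸ j))       ≡⟨ cong (at (rotate (x ∷ ds))) (m+[n∸m]≡n j≤m) ⟩
  at (rotate (x ∷ ds)) (length ds)                 ≡⟨ at-++-length ds _ [] ⟩
  closing (x ∷ ds)                                 ∎
  where
  open ≡-Reasoning
  j+t<n : j + (length ds ∸ j) < length (rotate (x ∷ ds))
  j+t<n = subst₂ _<_ (sym (m+[n∸m]≡n j≤m)) (sym (length-rotate (x ∷ ds))) (n<1+n (length ds))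

-- Gluing and ears

-- Gluing the polygons of two structures along an edge through vertex 0: the last vertex of the
-- first is identified with the first vertex of the second, so their entries add up.
glue : List ℕ → List ℕ → List ℕ
glue []           ys       = ys
glue (x ∷ [])     []       = x ∷ []
glue (x ∷ [])     (y ∷ ys) = (x + y) ∷ ys
glue (x ∷ x' ∷ xs) ys      = x ∷ glue (x' ∷ xs) ys

chain-glue : ∀ {a b x A y B u v} → Chain a b (x ∷ A) 1 0 → Chain 0 1 (y ∷ B) u v →
             Chain a b (glue (x ∷ A) (y ∷ B)) u v
chain-glue {a} {x = x} {[]} (cons {c = c} e nil) (cons {c = c'} e' ch') =
  cons (trans (*-distribʳ-+ 1 x _) (trans (cong₂ _+_ e e') (cong (_+ c') (+-identityʳ a)))) ch'
chain-glue {A = _ ∷ _} (cons e ch) ch' = cons e (chain-glue ch ch')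

arith-glue : ∀ {A B} → Arith A → Arith B → Arith (glue A B)
arith-glue {_ ∷ _} {_ ∷ _} = chain-glue

chain-glue-closing : ∀ {a b x A α y B β} → Chain a b (x ∷ A) α 1 → Chain 1 y B 1 0 → Chain 0 1 B β 1 →
                     Chain a b (glue (x ∷ A) (y ∷ B)) (α + β) 1
chain-glue-closing {a} {x = x} {[]} {α} {y} (cons e nil) chB clB =
  cons eq (chain-cast (trans (+-identityʳ _) (*-identityʳ α)) refl (cong (_+ _) (*-identityʳ α))
                      (cong (_+ 1) (*-zeroʳ α)) (chain-+ (chain-scale α chB) clB))
  where
  rearrange : ∀ p q r → p + 1 + q * r ≡ p + (r * q + 1)
  rearrange = solve-∀
  eq : (x + y) * α ≡ a + (α * y + 1)
  eq = trans (*-distribʳ-+ α x y) (trans (cong (_+ y * α) e) (rearrange a y α))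
chain-glue-closing {A = _ ∷ _} (cons e ch) chB clB = cons e (chain-glue-closing ch chB clB)

closing-glue : ∀ {A B} → Arith A → Arith B → closing (glue A B) ≡ closing A + closing B
closing-glue {_ ∷ []}     {_ ∷ _} sA sB = refl
closing-glue {_ ∷ _ ∷ _} {_ ∷ _} sA sB =
  cong proj₁ (run-chain (chain-glue-closing (closing-chain sA) (arith-head sB) (closing-chain sB)))

glue-assoc : ∀ {A B C} → Arith A → Arith B → Arith C → glue (glue A B) C ≡ glue A (glue B C)
glue-assoc {x ∷ A} {y ∷ B} {z ∷ C} _ _ _ = assoc x A y B z C
  where
  glue-∷ : ∀ x x' A y B C → glue (x ∷ glue (x' ∷ A) (y ∷ B)) C ≡ x ∷ glue (glue (x' ∷ A) (y ∷ B)) C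
  glue-∷ x x' []      y []      C = refl
  glue-∷ x x' []      y (_ ∷ _) C = refl
  glue-∷ x x' (_ ∷ _) y B       C = refl
  assoc : ∀ x A y B z C → glue (glue (x ∷ A) (y ∷ B)) (z ∷ C) ≡ glue (x ∷ A) (glue (y ∷ B) (z ∷ C))
  assoc x []       y []       z C = cong (_∷ C) (+-assoc x y z)
  assoc x []       y (_ ∷ _) z C = refl
  assoc x (x' ∷ A) y B        z C = trans (glue-∷ x x' A y B (z ∷ C)) (cong (x ∷_) (assoc x' A y B z C))

length-glue : ∀ {A B} → Arith A → Arith B → suc (length (glue A B)) ≡ length A + length B
length-glue {x ∷ A} {y ∷ B} _ _ = cong suc (len x A y B)
  where
  len : ∀ x A y B → length (glue (x ∷ A) (y ∷ B)) ≡ length A + suc (length B)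
  len x []       y B = refl
  len x (x' ∷ A) y B = cong suc (len x' A y B)

-- Attaching an ear to the edge between vertices 0 and 1: d(1) and d(0) grow by one, the old
-- vertex 0 becomes vertex n + 1, and the apex of the ear, with one triangle, the new vertex 0.
addEar : List ℕ → List ℕ
addEar []       = []
addEar (x ∷ ds) = suc x ∷ (ds ++ [ suc (closing (x ∷ ds)) ])

head+closing-chain : ∀ {x ds} → Arith (x ∷ ds) → Chain 1 (suc x) ds (suc (closing (x ∷ ds))) 1
head+closing-chain {x} s = chain-cast refl (+-comm x 1) refl refl (chain-+ (arith-head s) (closing-chain s))

arith-addEar : ∀ {e} → Arith e → Arith (addEar e)
arith-addEar {x ∷ ds} s =
  cons (*-identityʳ (suc x)) (chain-snoc (head+closing-chain s) (trans (*-identityʳ _) (sym (+-identityʳ _))))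

closing-addEar : ∀ {e} → Arith e → closing (addEar e) ≡ 1
closing-addEar {x ∷ ds} s = cong proj₁ (run-chain (chain-snoc (closing-chain s) (trans (*-identityʳ _) (+-comm 1 _))))

closing-addEar-glue : ∀ {e R} → Arith e → Arith R → closing (glue (addEar e) R) ≡ suc (closing R)
closing-addEar-glue se sR = trans (closing-glue (arith-addEar se) sR) (cong (_+ _) (closing-addEar se))

length-addEar-glue : ∀ {e R} → Arith e → Arith R → length (glue (addEar e) R) ≡ length e + length R
length-addEar-glue {x ∷ ds} {R} se sR = suc-injective (begin
  suc (length (glue (addEar (x ∷ ds)) R)) ≡⟨ length-glue (arith-addEar se) sR ⟩
  suc (length (ds ++ [ _ ])) + length R   ≡⟨ cong (λ l → suc l + length R) (length-++ ds) ⟩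
  suc (length ds + 1) + length R          ≡⟨ cong (λ l → suc l + length R) (+-comm (length ds) 1) ⟩
  suc (length (x ∷ ds) + length R)        ∎)
  where open ≡-Reasoning

glue-addEar : ∀ x ds y R → glue (addEar (x ∷ ds)) (y ∷ R) ≡ suc x ∷ (ds ++ (suc (closing (x ∷ ds)) + y) ∷ R)
glue-addEar x ds y R = glue-snoc (suc x) ds
  where
  glue-snoc : ∀ {l} u us → glue (u ∷ us ++ [ l ]) (y ∷ R) ≡ u ∷ (us ++ (l + y) ∷ R)
  glue-snoc u []        = refl
  glue-snoc u (u' ∷ us) = cong (u ∷_) (glue-snoc u' us)

-- The position of the first r-value 1 after vertex 1; it locates the diagonal cut by glue.
junction : List ℕ → ℕ
junction []       = 0
junction (x ∷ ds) = firstOne (values 1 x ds)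

junction-addEar-glue : ∀ {x ds y R} → Arith (x ∷ ds) → Arith (y ∷ R) →
                          junction (glue (addEar (x ∷ ds)) (y ∷ R)) ≡ length ds
junction-addEar-glue {x} {ds} {y} {R} s _ rewrite glue-addEar x ds y R = begin
  firstOne (values 1 (suc x) (ds ++ k ∷ R))                  ≡⟨ cong firstOne (values-++ (k ∷ R) (head+closing-chain s)) ⟩
  firstOne (values 1 (suc x) ds ++ values (suc c) 1 (k ∷ R)) ≡⟨ firstOne-++ _ values≥2 ⟩
  length (values 1 (suc x) ds)                               ≡⟨ length-values 1 (suc x) ds ⟩
  length ds                                                  ∎
  where
  open ≡-Reasoning
  c = closing (x ∷ ds)
  k = suc c + y
  values≥2 : All (2 ≤_) (values 1 (suc x) ds)
  values≥2 = subst (λ t → All (2 ≤_) (values 1 t ds)) (+-comm x 1)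
    (values-+ (arith-head s) (closing-chain s)
              (values-positive (arith-head s) (λ { (() , _) })) (values-positive (closing-chain s) (λ { (_ , ()) })))

addEar-glue-injective : ∀ {e₁ e₂ R₁ R₂} → Arith e₁ → Arith e₂ → Arith R₁ → Arith R₂ →
                           glue (addEar e₁) R₁ ≡ glue (addEar e₂) R₂ → e₁ ≡ e₂ × R₁ ≡ R₂
addEar-glue-injective {x₁ ∷ ds₁} {x₂ ∷ ds₂} {y₁ ∷ R₁} {y₂ ∷ R₂} s₁ s₂ t₁ t₂ eq
  with ∷-injective (trans (sym (glue-addEar x₁ ds₁ y₁ R₁)) (trans eq (glue-addEar x₂ ds₂ y₂ R₂)))
... | x₁+1≡x₂+1 , tails
  with ++-injective-length ds₁ ds₂ (trans (sym (junction-addEar-glue s₁ t₁))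
                                   (trans (cong junction eq) (junction-addEar-glue s₂ t₂))) tails
... | refl , rest with suc-injective x₁+1≡x₂+1 | ∷-injective rest
... | refl | junction-sum , refl = refl , cong (_∷ R₂) (+-cancelˡ-≡ (suc (closing (x₁ ∷ ds₁))) _ _ junction-sum)

decompose-ear : ∀ {k rest} → Chain 1 1 (k ∷ rest) 1 0 →
                ∃ λ e → ∃ λ R → Arith e × Arith R × 1 ∷ k ∷ rest ≡ glue (addEar e) R
decompose-ear {k} {rest} (cons {c = c} e ch) =
  0 ∷ [] , c ∷ rest , arith-0 , cons (*-identityʳ c) ch , cong (λ t → 1 ∷ t ∷ rest) (trans (sym (*-identityʳ k)) e)

positive-summand-of-1 : ∀ {u q p n} → u + q ≡ 1 → p * q ≡ suc n → q ≡ 1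
positive-summand-of-1 {q = zero} {p} _ pq = ⊥-elim (0≢1+n (trans (sym (*-zeroʳ p)) pq))
positive-summand-of-1 {q = suc zero} _ _ = refl
positive-summand-of-1 {u} {suc (suc q)} eq _ = ⊥-elim (<⇒≱ (s≤s (s≤s z≤n)) (subst (suc (suc q) ≤_) eq (m≤n+m _ u)))

-- Cut along the diagonal to the first vertex after vertex 1 with r-value 1; the part before it,
-- with its first entry lowered by one, is again a structure because subtracting the companion
-- chain starting at (0 , 1) stays in ℕ.
decompose-long : ∀ {X ds} → Chain 1 X ds 1 0 → 2 ≤ X →
                 ∃ λ e → ∃ λ R → Arith e × Arith R × X ∷ ds ≡ glue (addEar e) R
decompose-long {X} ch X≥2 with first-value-one ch X≥2
... | mid , p , k , rest , refl , ch-mid , mid≥2 , cons {c = c} ek ch-rest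
  with chain-companion {a' = 0} {b' = 1} ch-mid (cong suc (sym (*-zeroʳ X)))
... | P , Q , cl with chain-difference ch-mid cl (cong suc (sym (*-zeroʳ X))) (s≤s z≤n) mid≥2 (s≤s z≤n) 1 refl
... | u , uy , uz , u+1≡X , ch-e , uy+P≡p , uz+Q≡1 =
  u ∷ mid , c ∷ rest , arith-e , cons (*-identityʳ c) ch-rest , shape
  where
  pQ≡1+P : p * Q ≡ suc P
  pQ≡1+P = trans (sym (cong (_+ p * Q) (*-zeroʳ X))) (trans (sym (chain-det ch-mid cl)) (cong suc (*-identityˡ P)))
  Q≡1 : Q ≡ 1
  Q≡1 = positive-summand-of-1 {p = p} uz+Q≡1 pQ≡1+P
  p≡1+P : p ≡ suc P
  p≡1+P = trans (sym (*-identityʳ p)) (trans (cong (p *_) (sym Q≡1)) pQ≡1+P)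
  arith-e : Arith (u ∷ mid)
  arith-e = cons (*-identityʳ u)
    (chain-cast refl refl (+-cancelʳ-≡ P uy 1 (trans uy+P≡p p≡1+P))
                          (+-cancelʳ-≡ Q uz 0 (trans uz+Q≡1 (cong (0 +_) (sym Q≡1)))) ch-e)
  shape : X ∷ (mid ++ k ∷ rest) ≡ glue (addEar (u ∷ mid)) (c ∷ rest)
  shape = begin
    X ∷ (mid ++ k ∷ rest)                                 ≡⟨ cong (λ t → X ∷ (mid ++ t ∷ rest)) (trans (sym (*-identityʳ k)) ek) ⟩
    X ∷ (mid ++ (p + c) ∷ rest)                           ≡⟨ cong₂ (λ t t' → t ∷ (mid ++ (t' + c) ∷ rest))
                                                                  (trans (sym u+1≡X) (+-comm u 1))
                                                                  (trans p≡1+P (cong suc (sym (cong proj₁ (run-chain cl))))) ⟩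
    suc u ∷ (mid ++ (suc (closing (u ∷ mid)) + c) ∷ rest) ≡⟨ sym (glue-addEar u mid c rest) ⟩
    glue (addEar (u ∷ mid)) (c ∷ rest)                    ∎
    where open ≡-Reasoning

decompose : ∀ {d} → Arith d → 2 ≤ length d → ∃ λ e → ∃ λ R → Arith e × Arith R × d ≡ glue (addEar e) R
decompose {x ∷ []}       s (s≤s ())
decompose {x ∷ k ∷ rest} s _ with arith-head s | values-positive (arith-head s) (λ { (() , _) })
... | ch | x≥1 ∷ _ with x | ch | x≥1
... | suc zero      | ch' | _ = decompose-ear ch'
... | suc (suc x')  | ch' | _ = decompose-long ch' (s≤s (s≤s z≤n))

closing-positive : ∀ {d} → Arith d → 2 ≤ length d → 1 ≤ closing d
closing-positive s n≥2 with decompose s n≥2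
... | e , R , se , sR , refl = subst (1 ≤_) (sym (closing-addEar-glue se sR)) (s≤s z≤n)

closing-positive⇒length≥2 : ∀ {d} → Arith d → 1 ≤ closing d → 2 ≤ length d
closing-positive⇒length≥2 {x ∷ []}    s ()
closing-positive⇒length≥2 {x ∷ _ ∷ _} s _ = s≤s (s≤s z≤n)

closing≡0 : ∀ {d} → Arith d → closing d ≡ 0 → d ≡ 0 ∷ []
closing≡0 {x ∷ []}    s _  = cong (_∷ []) (arith-singleton s)
closing≡0 {x ∷ _ ∷ _} s c≡0 with subst (1 ≤_) c≡0 (closing-positive s (s≤s (s≤s z≤n)))
... | ()

closing<length : ∀ {d} → Arith d → closing d < length d
closing<length s = bounded _ s ≤-refl
  where
  bounded : ∀ m {d} → Arith d → length d ≤ m → closing d < length d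
  bounded m       {x ∷ []}    s _ = s≤s z≤n
  bounded (suc m) {d@(_ ∷ _ ∷ _)} s n≤1+m with decompose s (s≤s (s≤s z≤n))
  ... | e , R , se , sR , d≡ = subst (λ t → closing t < length t) (sym d≡) (begin-strict
    closing (glue (addEar e) R) ≡⟨ closing-addEar-glue se sR ⟩
    suc (closing R)             <⟨ s≤s (bounded m sR R≤m) ⟩
    suc (length R)              ≤⟨ +-monoˡ-≤ (length R) e≥1 ⟩
    length e + length R         ≡⟨ sym (length-addEar-glue se sR) ⟩
    length (glue (addEar e) R)  ∎)
    where
    open ≤-Reasoning
    e≥1 : 1 ≤ length e
    e≥1 with arith-nonempty se
    ... | _ , _ , refl = s≤s z≤n
    R≤m : length R ≤ m
    R≤m = ≤-pred (≤-trans (+-monoˡ-≤ (length R) e≥1)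
                          (≤-trans (≤-reflexive (sym (length-addEar-glue se sR)))
                                   (subst (λ t → length t ≤ suc m) d≡ n≤1+m)))

split : ∀ t {d} → Arith d → t ≤ closing d →
        ∃ λ X → ∃ λ R → Arith X × Arith R × closing X ≡ t × d ≡ glue X R
split zero    {d} s _ = 0 ∷ [] , d , arith-0 , s , refl , sym (glue-0 (arith-nonempty s))
  where
  glue-0 : ∀ {d} → ∃ (λ x → ∃ λ ds → d ≡ x ∷ ds) → glue (0 ∷ []) d ≡ d
  glue-0 (_ , _ , refl) = refl
split (suc t) s t<c with decompose s (closing-positive⇒length≥2 s (≤-trans (s≤s z≤n) t<c))
... | e , R' , se , sR' , refl with split t sR' (≤-pred (subst (suc t ≤_) (closing-addEar-glue se sR') t<c))
... | X , R , sX , sR , closing-X , refl =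
  glue (addEar e) X , R , arith-glue (arith-addEar se) sX , sR ,
  trans (closing-addEar-glue se sX) (cong suc closing-X) ,
  sym (glue-assoc (arith-addEar se) sX sR)

split-unique : ∀ t {X₁ R₁ X₂ R₂} → Arith X₁ → Arith R₁ → Arith X₂ → Arith R₂ →
               closing X₁ ≡ t → closing X₂ ≡ t →
               glue X₁ R₁ ≡ glue X₂ R₂ → X₁ ≡ X₂ × R₁ ≡ R₂
split-unique zero {R₁ = _ ∷ _} {R₂ = _ ∷ _} sX₁ _ sX₂ _ c₁ c₂ eq
  with closing≡0 sX₁ c₁ | closing≡0 sX₂ c₂
... | refl | refl = refl , eq
split-unique (suc t) {R₁ = R₁} {R₂ = R₂} sX₁ sR₁ sX₂ sR₂ c₁ c₂ eq
  with decompose sX₁ (closing-positive⇒length≥2 sX₁ (subst (1 ≤_) (sym c₁) (s≤s z≤n)))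
     | decompose sX₂ (closing-positive⇒length≥2 sX₂ (subst (1 ≤_) (sym c₂) (s≤s z≤n)))
... | e₁ , Y₁ , se₁ , sY₁ , refl | e₂ , Y₂ , se₂ , sY₂ , refl
  with addEar-glue-injective se₁ se₂ (arith-glue sY₁ sR₁) (arith-glue sY₂ sR₂)
         (trans (sym (glue-assoc (arith-addEar se₁) sY₁ sR₁)) (trans eq (glue-assoc (arith-addEar se₂) sY₂ sR₂)))
... | refl , eq' with split-unique t sY₁ sR₁ sY₂ sR₂ (suc-injective (trans (sym (closing-addEar-glue se₁ sY₁)) c₁))
                                                   (suc-injective (trans (sym (closing-addEar-glue se₂ sY₂)) c₂)) eq'
... | refl , refl = refl , refl

Structure : Set
Structure = Σ (List ℕ) Arith

lift : ℕ → Structure → Structure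
lift v (d , s) with split (closing d ∸ v) s (m∸n≤m (closing d) v)
... | X , R , sX , sR , _ = glue (addEar (unrotate X)) R , arith-glue (arith-addEar (arith-unrotate sX)) sR

structures : ℕ → ℕ → List Structure
structures zero          v       = []
structures (suc zero)    zero    = (0 ∷ [] , arith-0) ∷ []
structures (suc zero)    (suc v) = []
structures (suc (suc m)) zero    = []
structures (suc (suc m)) (suc v) = map (lift v) (between (structures (suc m)) (suc (suc m)) v)

length-closing-lift : ∀ v d (s : Arith d) → v ≤ closing d →
               length (proj₁ (lift v (d , s))) ≡ suc (length d) × closing (proj₁ (lift v (d , s))) ≡ suc v
length-closing-lift v d s v≤c with split (closing d ∸ v) s (m∸n≤m (closing d) v)
... | X , R , sX , sR , closing-X , refl =
  trans (length-addEar-glue (arith-unrotate sX) sR)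
        (trans (cong (_+ length R) (length-unrotate X)) (sym (length-glue sX sR))) ,
  trans (closing-addEar-glue (arith-unrotate sX) sR) (cong suc closing-R)
  where
  closing-R : closing R ≡ v
  closing-R = +-cancelˡ-≡ (closing (glue X R) ∸ v) _ _ (begin
    closing (glue X R) ∸ v + closing R ≡⟨ cong (_+ closing R) (sym closing-X) ⟩
    closing X + closing R              ≡⟨ sym (closing-glue sX sR) ⟩
    closing (glue X R)                 ≡⟨ sym (m∸n+n≡m v≤c) ⟩
    closing (glue X R) ∸ v + v         ∎)
    where open ≡-Reasoning

lift-glue : ∀ v d (s : Arith d) {X R} → Arith X → Arith R → closing X ≡ closing d ∸ v → d ≡ glue X R →
            proj₁ (lift v (d , s)) ≡ glue (addEar (unrotate X)) R
lift-glue v d s sX sR closing-X d≡ with split (closing d ∸ v) s (m∸n≤m (closing d) v)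
... | X' , R' , sX' , sR' , closing-X' , d≡'
  with split-unique (closing d ∸ v) sX' sR' sX sR closing-X' closing-X (trans (sym d≡') d≡)
... | refl , refl = refl

lift-injective : ∀ v c₁ c₂ → proj₁ (lift v c₁) ≡ proj₁ (lift v c₂) → proj₁ c₁ ≡ proj₁ c₂
lift-injective v (d₁ , s₁) (d₂ , s₂) eq
  with split (closing d₁ ∸ v) s₁ (m∸n≤m (closing d₁) v) | split (closing d₂ ∸ v) s₂ (m∸n≤m (closing d₂) v)
... | X₁ , R₁ , sX₁ , sR₁ , _ , refl | X₂ , R₂ , sX₂ , sR₂ , _ , refl
  with addEar-glue-injective (arith-unrotate sX₁) (arith-unrotate sX₂) sR₁ sR₂ eq
... | unrotate-X≡ , refl = cong (λ X → glue X R₁) (begin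
  X₁                   ≡⟨ sym (rotate-unrotate sX₁) ⟩
  rotate (unrotate X₁) ≡⟨ cong rotate unrotate-X≡ ⟩
  rotate (unrotate X₂) ≡⟨ rotate-unrotate sX₂ ⟩
  X₂                   ∎)
  where open ≡-Reasoning

structures-sound : ∀ n v {c} → c ∈ structures n v → length (proj₁ c) ≡ n × closing (proj₁ c) ≡ v
structures-sound (suc zero)    zero    (here refl) = refl , refl
structures-sound (suc (suc m)) (suc v) c∈ =
  let (d , s) , c'∈ , c≡ = ∈-map⁻ (lift v) c∈
      u , v≤u , _ , c'∈u = ∈-between⁻ (structures (suc m)) (suc (suc m)) v c'∈
      length-d , closing-d = structures-sound (suc m) u c'∈u
      length-lift , closing-lifted = length-closing-lift v d s (subst (v ≤_) (sym closing-d) v≤u)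
  in subst (λ c → length (proj₁ c) ≡ suc (suc m) × closing (proj₁ c) ≡ suc v) (sym c≡)
           (trans length-lift (cong suc length-d) , closing-lifted)

lift-complete : ∀ m v {e R} → Arith e → Arith R → length (glue (addEar e) R) ≡ suc (suc m) → closing R ≡ v →
  (∀ u {d} (s : Arith d) → length d ≡ suc m → closing d ≡ u → ∃ λ c → c ∈ structures (suc m) u × proj₁ c ≡ d) →
  ∃ λ c → c ∈ structures (suc (suc m)) (suc v) × proj₁ c ≡ glue (addEar e) R
lift-complete m v {e} {R} se sR length-d closing-R complete = lifted (complete (closing d') sd' length-d' refl)
  where
  open ≡-Reasoning
  d' = glue (rotate e) R
  sd' : Arith d'
  sd' = arith-glue (arith-rotate se) sR
  closing-d' : closing d' ≡ closing (rotate e) + v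
  closing-d' = trans (closing-glue (arith-rotate se) sR) (cong (closing (rotate e) +_) closing-R)
  length-d' : length d' ≡ suc m
  length-d' = suc-injective (begin
    suc (length d')              ≡⟨ length-glue (arith-rotate se) sR ⟩
    length (rotate e) + length R ≡⟨ cong (_+ length R) (length-rotate e) ⟩
    length e + length R          ≡⟨ sym (length-addEar-glue se sR) ⟩
    length (glue (addEar e) R)   ≡⟨ length-d ⟩
    suc (suc m)                  ∎)
  v≤closing : v ≤ closing d'
  v≤closing = subst (v ≤_) (sym closing-d') (m≤n+m v (closing (rotate e)))
  closing<bound : closing d' < v + suc (suc m)
  closing<bound = ≤-trans (subst (closing d' <_) length-d' (closing<length sd'))
                          (≤-trans (n≤1+n (suc m)) (m≤n+m (suc (suc m)) v))
  lifted : (∃ λ c → c ∈ structures (suc m) (closing d') × proj₁ c ≡ d') →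
           ∃ λ c → c ∈ structures (suc (suc m)) (suc v) × proj₁ c ≡ glue (addEar e) R
  lifted ((_ , s') , c'∈ , refl) =
    lift v (d' , s') ,
    ∈-map⁺ (lift v) (∈-between⁺ (structures (suc m)) (suc (suc m)) v v≤closing closing<bound c'∈) ,
    (begin
      proj₁ (lift v (d' , s'))              ≡⟨ lift-glue v d' s' (arith-rotate se) sR
                                                    (sym (trans (cong (_∸ v) closing-d') (m+n∸n≡m _ v))) refl ⟩
      glue (addEar (unrotate (rotate e))) R ≡⟨ cong (λ X → glue (addEar X) R) (unrotate-rotate se) ⟩
      glue (addEar e) R                     ∎)

structures-complete : ∀ n v {d} (s : Arith d) → length d ≡ n → closing d ≡ v →
                      ∃ λ c → c ∈ structures n v × proj₁ c ≡ d
structures-complete zero       v {_ ∷ _}     s ()   _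
structures-complete (suc zero) v {_ ∷ []}    s _    refl = _ , here refl , cong (_∷ []) (sym (arith-singleton s))
structures-complete (suc zero) v {_ ∷ _ ∷ _} s ()   _
structures-complete (suc (suc m)) zero s length-d c≡0 =
  ⊥-elim (<⇒≢ (closing-positive s (subst (2 ≤_) (sym length-d) (s≤s (s≤s z≤n)))) (sym c≡0))
structures-complete (suc (suc m)) (suc v) s length-d c≡1+v =
  let e , R , se , sR , d≡ = decompose s (subst (2 ≤_) (sym length-d) (s≤s (s≤s z≤n)))
      closing-R = suc-injective (trans (sym (closing-addEar-glue se sR)) (trans (cong closing (sym d≡)) c≡1+v))
  in subst (λ d → ∃ λ c → c ∈ structures (suc (suc m)) (suc v) × proj₁ c ≡ d) (sym d≡)
           (lift-complete m v se sR (trans (cong length (sym d≡)) length-d) closing-R (structures-complete (suc m)))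

structures-unique : ∀ n v → Unique (map proj₁ (structures n v))
structures-unique zero          v       = []
structures-unique (suc zero)    zero    = [] ∷ []
structures-unique (suc zero)    (suc v) = []
structures-unique (suc (suc m)) zero    = []
structures-unique (suc (suc m)) (suc v) =
  subst Unique (map-∘ {g = proj₁} {f = lift v} L)
    (unique-map-reflect proj₁ (proj₁ ∘ lift v) (λ _ → ⊤) L (All.universal _ L)
                        (λ {c₁} {c₂} _ _ → lift-injective v c₁ c₂)
                        (unique-between (structures (suc m)) proj₁ closing (structures-unique (suc m))
                                        (λ u c∈ → proj₂ (structures-sound (suc m) u c∈)) (suc (suc m)) v))
  where
  L = between (structures (suc m)) (suc (suc m)) v

-- Ballot numbers

-- Paths with k east and l north steps starting h steps to the right of the diagonal that never
-- cross it, counted by their first step.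
ballotFrom : ℕ → ℕ → ℕ → ℕ
ballotFrom h       zero    zero    = 1
ballotFrom h       (suc k) zero    = ballotFrom (suc h) k zero
ballotFrom zero    zero    (suc l) = 0
ballotFrom (suc h) zero    (suc l) = ballotFrom h zero l
ballotFrom zero    (suc k) (suc l) = ballotFrom 1 k (suc l)
ballotFrom (suc h) (suc k) (suc l) = ballotFrom (suc (suc h)) k (suc l) + ballotFrom h (suc k) l

ballotFrom-east : ∀ h k → ballotFrom h k 0 ≡ 1
ballotFrom-east h zero    = refl
ballotFrom-east h (suc k) = ballotFrom-east (suc h) k

ballotFrom-north : ∀ {h l} → l ≤ h → ballotFrom h 0 l ≡ 1
ballotFrom-north {l = zero}  _         = refl
ballotFrom-north {suc h} {suc l} (s≤s l≤h) = ballotFrom-north l≤h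

ballotFrom-above : ∀ h k l → h + k < l → ballotFrom h k l ≡ 0
ballotFrom-above zero    zero    (suc l) _ = refl
ballotFrom-above (suc h) zero    (suc l) (s≤s h<l) = ballotFrom-above h zero l h<l
ballotFrom-above zero    (suc k) (suc l) (s≤s k<l) = ballotFrom-above 1 k (suc l) (s≤s k<l)
ballotFrom-above (suc h) (suc k) (suc l) (s≤s h+1+k<l) =
  cong₂ _+_ (ballotFrom-above (suc (suc h)) k (suc l) (s≤s (subst (_< l) (+-suc h k) h+1+k<l)))
            (ballotFrom-above h (suc k) l h+1+k<l)

ballotFrom-1+ : ∀ k l → ballotFrom 0 (suc k) l ≡ ballotFrom 1 k l
ballotFrom-1+ k zero    = refl
ballotFrom-1+ k (suc l) = refl

-- The same numbers, counted by the last step.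
ballotFrom-last : ∀ h k l → l ≤ h + k → ballotFrom h (suc k) (suc l) ≡ ballotFrom h k (suc l) + ballotFrom h (suc k) l
ballotFrom-last zero    zero    zero     _ = refl
ballotFrom-last (suc h) zero    zero     _ = refl
ballotFrom-last (suc h) zero    (suc l) (s≤s l≤h+0) = begin
  G h 0 l + G h 1 (suc l)                   ≡⟨ cong (G h 0 l +_) (ballotFrom-last h 0 l l≤h+0) ⟩
  G h 0 l + (G h 0 (suc l) + G h 1 l)       ≡⟨ rearrange (G h 0 l) (G h 0 (suc l)) (G h 1 l) ⟩
  G h 0 (suc l) + (G h 0 l + G h 1 l)       ≡⟨ cong (λ t → G h 0 (suc l) + (t + G h 1 l)) north ⟩
  G h 0 (suc l) + (G (suc h) 0 l + G h 1 l) ∎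
  where
  open ≡-Reasoning
  G = ballotFrom
  rearrange : ∀ a b c → a + (b + c) ≡ b + (a + c)
  rearrange = solve-∀
  l≤h : l ≤ h
  l≤h = subst (l ≤_) (+-identityʳ h) l≤h+0
  north : ballotFrom h 0 l ≡ ballotFrom (suc h) 0 l
  north = trans (ballotFrom-north l≤h) (sym (ballotFrom-north (m≤n⇒m≤1+n l≤h)))
ballotFrom-last zero    (suc k) l       l≤1+k =
  trans (ballotFrom-last 1 k l l≤1+k) (cong (ballotFrom 1 k (suc l) +_) (sym (ballotFrom-1+ (suc k) l)))
ballotFrom-last (suc h) (suc k) zero    _ =
  cong₂ _+_ (trans (ballotFrom-last (suc (suc h)) k 0 z≤n)
                   (cong (ballotFrom (suc (suc h)) k 1 +_) (east (suc (suc h)) (suc k) h (suc k))))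
            (east h (suc (suc k)) (suc h) (suc (suc k)))
  where
  east : ∀ h k h' k' → ballotFrom h k 0 ≡ ballotFrom h' k' 0
  east h k h' k' = trans (ballotFrom-east h k) (sym (ballotFrom-east h' k'))
ballotFrom-last (suc h) (suc k) (suc l) l+1≤h+1+k+1 = begin
  G (2 + h) (suc k) (2 + l) + G h (2 + k) (suc l)
    ≡⟨ cong₂ _+_ (ballotFrom-last (suc (suc h)) k (suc l) (subst (suc l ≤_) (cong suc (+-suc h k)) l+1≤h+1+k+1))
                 (ballotFrom-last h (suc k) l (≤-pred l+1≤h+1+k+1)) ⟩
  (G (2 + h) k (2 + l) + G (2 + h) (suc k) (suc l)) + (G h (suc k) (suc l) + G h (2 + k) l)
    ≡⟨ rearrange (G (2 + h) k (2 + l)) _ _ _ ⟩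
  (G (2 + h) k (2 + l) + G h (suc k) (suc l)) + (G (2 + h) (suc k) (suc l) + G h (2 + k) l)
    ∎
  where
  open ≡-Reasoning
  G = ballotFrom
  rearrange : ∀ a b c d → (a + b) + (c + d) ≡ (a + c) + (b + d)
  rearrange = solve-∀

count : (List Step → Bool) → List (List Step) → ℕ
count f []       = 0
count f (p ∷ ps) = if f p then suc (count f ps) else count f ps

length-filter : ∀ f ps → length (filter (λ p → f p Bool.≟ true) ps) ≡ count f ps
length-filter f []       = refl
length-filter f (p ∷ ps) with f p
... | true  = cong suc (length-filter f ps)
... | false = length-filter f ps

count-++ : ∀ f xs ys → count f (xs ++ ys) ≡ count f xs + count f ys
count-++ f []       ys = refl
count-++ f (x ∷ xs) ys with f x
... | true  = cong suc (count-++ f xs ys)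
... | false = count-++ f xs ys

count-map : ∀ f g ps → count f (map g ps) ≡ count (f ∘ g) ps
count-map f g []       = refl
count-map f g (p ∷ ps) with f (g p)
... | true  = cong suc (count-map f g ps)
... | false = count-map f g ps

count-cong : ∀ {f g} ps → (∀ p → f p ≡ g p) → count f ps ≡ count g ps
count-cong         []       f≗g = refl
count-cong {f} {g} (p ∷ ps) f≗g with f p | g p | f≗g p
... | true  | true  | refl = cong suc (count-cong ps f≗g)
... | false | false | refl = count-cong ps f≗g

count-false : ∀ ps → count (λ _ → false) ps ≡ 0
count-false []       = refl
count-false (p ∷ ps) = count-false ps

≤ᵇ-suc : ∀ y x → (suc y ≤ᵇ suc x) ≡ (y ≤ᵇ x)
≤ᵇ-suc zero    x = refl
≤ᵇ-suc (suc y) x = refl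

neverAbove-suc : ∀ x y p → neverAbove (suc x) (suc y) p ≡ neverAbove x y p
neverAbove-suc x y []      = ≤ᵇ-suc y x
neverAbove-suc x y (E ∷ p) = cong₂ _∧_ (≤ᵇ-suc y x) (neverAbove-suc (suc x) y p)
neverAbove-suc x y (N ∷ p) = cong₂ _∧_ (≤ᵇ-suc y x) (neverAbove-suc x (suc y) p)

neverAbove-from-above : ∀ {x y} → (y ≤ᵇ x) ≡ false → ∀ p → neverAbove x y p ≡ false
neverAbove-from-above y>x []      = y>x
neverAbove-from-above {x} {y} y>x (E ∷ p) = cong (_∧ neverAbove (suc x) y p) y>x
neverAbove-from-above {x} {y} y>x (N ∷ p) = cong (_∧ neverAbove x (suc y) p) y>x

count-north-from-diagonal : ∀ ps → count (neverAbove 0 0 ∘ (N ∷_)) ps ≡ 0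
count-north-from-diagonal ps = trans (count-cong ps (neverAbove-from-above refl)) (count-false ps)

count-north : ∀ h ps → count (neverAbove (suc h) 0 ∘ (N ∷_)) ps ≡ count (neverAbove h 0) ps
count-north h ps = count-cong ps (neverAbove-suc h 0)

count-neverAbove : ∀ h k l → count (neverAbove h 0) (paths k l) ≡ ballotFrom h k l
count-neverAbove h       zero    zero    = refl
count-neverAbove h       (suc k) zero    =
  trans (count-map (neverAbove h 0) (E ∷_) (paths k 0)) (count-neverAbove (suc h) k zero)
count-neverAbove zero    zero    (suc l) =
  trans (count-map (neverAbove 0 0) (N ∷_) (paths 0 l)) (count-north-from-diagonal (paths 0 l))
count-neverAbove (suc h) zero    (suc l) =
  trans (count-map (neverAbove (suc h) 0) (N ∷_) (paths 0 l)) (trans (count-north h (paths 0 l)) (count-neverAbove h zero l))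
count-neverAbove zero    (suc k) (suc l) = begin
  count (neverAbove 0 0) (map (E ∷_) (paths k (suc l)) ++ map (N ∷_) (paths (suc k) l))
    ≡⟨ count-++ (neverAbove 0 0) (map (E ∷_) (paths k (suc l))) _ ⟩
  count (neverAbove 0 0) (map (E ∷_) (paths k (suc l))) + count (neverAbove 0 0) (map (N ∷_) (paths (suc k) l))
    ≡⟨ cong₂ _+_ (trans (count-map _ (E ∷_) (paths k (suc l))) (count-neverAbove 1 k (suc l)))
                 (trans (count-map _ (N ∷_) (paths (suc k) l)) (count-north-from-diagonal (paths (suc k) l))) ⟩
  ballotFrom 1 k (suc l) + 0
    ≡⟨ +-identityʳ _ ⟩
  ballotFrom 1 k (suc l) ∎
  where open ≡-Reasoning
count-neverAbove (suc h) (suc k) (suc l) = begin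
  count (neverAbove (suc h) 0) (map (E ∷_) (paths k (suc l)) ++ map (N ∷_) (paths (suc k) l))
    ≡⟨ count-++ (neverAbove (suc h) 0) (map (E ∷_) (paths k (suc l))) _ ⟩
  count (neverAbove (suc h) 0) (map (E ∷_) (paths k (suc l))) + count (neverAbove (suc h) 0) (map (N ∷_) (paths (suc k) l))
    ≡⟨ cong₂ _+_ (trans (count-map _ (E ∷_) (paths k (suc l))) (count-neverAbove (suc (suc h)) k (suc l)))
                 (trans (count-map _ (N ∷_) (paths (suc k) l)) (trans (count-north h (paths (suc k) l)) (count-neverAbove h (suc k) l))) ⟩
  ballotFrom (suc (suc h)) k (suc l) + ballotFrom h (suc k) l ∎
  where open ≡-Reasoning

ballot≡ballotFrom : ∀ k l → ballot k l ≡ ballotFrom 0 k l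
ballot≡ballotFrom k l = trans (length-filter (neverAbove 0 0) (paths k l)) (count-neverAbove 0 k l)

ballot-east : ∀ k → ballot k 0 ≡ 1
ballot-east k = trans (ballot≡ballotFrom k 0) (ballotFrom-east 0 k)

ballot-above : ∀ {k l} → k < l → ballot k l ≡ 0
ballot-above {k} {l} k<l = trans (ballot≡ballotFrom k l) (ballotFrom-above 0 k l k<l)

ballot-last : ∀ {k l} → l ≤ k → ballot (suc k) (suc l) ≡ ballot k (suc l) + ballot (suc k) l
ballot-last {k} {l} l≤k = begin
  ballot (suc k) (suc l)                          ≡⟨ ballot≡ballotFrom (suc k) (suc l) ⟩
  ballotFrom 0 (suc k) (suc l)                    ≡⟨ ballotFrom-last 0 k l l≤k ⟩
  ballotFrom 0 k (suc l) + ballotFrom 0 (suc k) l ≡⟨ sym (cong₂ _+_ (ballot≡ballotFrom k (suc l)) (ballot≡ballotFrom (suc k) l)) ⟩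
  ballot k (suc l) + ballot (suc k) l             ∎
  where open ≡-Reasoning

length-structures-beyond : ∀ n v → n ≤ v → length (structures n v) ≡ 0
length-structures-beyond n v n≤v = empty (structures n v) absent
  where
  empty : ∀ (xs : List Structure) → (∀ {c} → c ∈ xs → ⊥) → length xs ≡ 0
  empty []      _ = refl
  empty (_ ∷ _) ∉ = ⊥-elim (∉ (here refl))
  absent : ∀ {c} → c ∈ structures n v → ⊥
  absent {d , s} c∈ with structures-sound n v c∈
  ... | length-d , closing-d =
    <⇒≱ (closing<length s) (subst₂ _≤_ (sym length-d) (sym closing-d) n≤v)

-- Summing over the closing values of the smaller structures is the last-step recursion of ballot numbers.
length-between-structures : ∀ m → (∀ w k → w + k ≡ m → length (structures (suc (suc m)) (suc w)) ≡ ballot m k) →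
  ∀ k w f → w + k ≡ suc m → k < f → length (between (structures (suc (suc m))) f w) ≡ ballot (suc m) k
length-between-structures m IH zero w (suc f) w+0≡1+m _ rewrite trans (sym (+-identityʳ w)) w+0≡1+m = begin
  length (structures (suc (suc m)) (suc m) ++ between (structures (suc (suc m))) f (suc (suc m)))
    ≡⟨ length-++ (structures (suc (suc m)) (suc m)) ⟩
  length (structures (suc (suc m)) (suc m)) + length (between (structures (suc (suc m))) f (suc (suc m)))
    ≡⟨ cong₂ _+_ (IH m 0 (+-identityʳ m)) (length-between-empty f ≤-refl) ⟩
  ballot m 0 + 0
    ≡⟨ trans (+-identityʳ _) (trans (ballot-east m) (sym (ballot-east (suc m)))) ⟩
  ballot (suc m) 0 ∎
  where
  open ≡-Reasoning
  length-between-empty : ∀ f {v} → suc (suc m) ≤ v → length (between (structures (suc (suc m))) f v) ≡ 0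
  length-between-empty zero    _   = refl
  length-between-empty (suc f) {v} m+2≤v = trans (length-++ (structures (suc (suc m)) v))
    (cong₂ _+_ (length-structures-beyond (suc (suc m)) v m+2≤v) (length-between-empty f (m≤n⇒m≤1+n m+2≤v)))
length-between-structures m IH (suc k) w (suc f) w+1+k≡1+m (s≤s k<f) = begin
  length (structures (suc (suc m)) w ++ between (structures (suc (suc m))) f (suc w))
    ≡⟨ length-++ (structures (suc (suc m)) w) ⟩
  length (structures (suc (suc m)) w) + length (between (structures (suc (suc m))) f (suc w))
    ≡⟨ cong₂ _+_ (first w w+1+k≡1+m)
                 (length-between-structures m IH k (suc w) f (trans (sym (+-suc w k)) w+1+k≡1+m) k<f) ⟩
  ballot m (suc k) + ballot (suc m) k
    ≡⟨ sym (ballot-last k≤m) ⟩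
  ballot (suc m) (suc k) ∎
  where
  open ≡-Reasoning
  k≤m : k ≤ m
  k≤m = ≤-pred (subst (suc k ≤_) w+1+k≡1+m (m≤n+m (suc k) w))
  first : ∀ w → w + suc k ≡ suc m → length (structures (suc (suc m)) w) ≡ ballot m (suc k)
  first zero     k+1≡m+1 = sym (ballot-above (≤-reflexive (sym k+1≡m+1)))
  first (suc w') eq      = IH w' (suc k) (suc-injective eq)

length-structures : ∀ m w k → w + k ≡ m → length (structures (suc (suc m)) (suc w)) ≡ ballot m k
length-structures zero    zero zero _ = refl
length-structures (suc m) w    k    w+k≡1+m =
  trans (length-map (lift w) (between (structures (suc (suc m))) (suc (suc (suc m))) w))
        (length-between-structures m (length-structures m) k w (suc (suc (suc m))) w+k≡1+m
                                   (s≤s (≤-trans (subst (k ≤_) w+k≡1+m (m≤n+m k w)) (n≤1+n (suc m)))))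

δ : ℕ → ℕ → ℕ
δ a b = if a ≡ᵇ b then 1 else 0

δ-≡ : ∀ {a b} → a ≡ b → δ a b ≡ 1
δ-≡ {zero}  refl = refl
δ-≡ {suc a} refl = δ-≡ {a} refl

δ-≢ : ∀ {a b} → a ≢ b → δ a b ≡ 0
δ-≢ {zero}  {zero}  a≢b = ⊥-elim (a≢b refl)
δ-≢ {zero}  {suc b} _   = refl
δ-≢ {suc a} {zero}  _   = refl
δ-≢ {suc a} {suc b} a≢b = δ-≢ {a} {b} (a≢b ∘ cong suc)

adjP-δ : ∀ n (i j : Fin n) → adjP n i j ≡ δ (toℕ j) (suc (toℕ i)) + δ (toℕ i) (suc (toℕ j))
adjP-δ n i j with toℕ j ≟ suc (toℕ i) | toℕ i ≟ suc (toℕ j)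
... | yes j≡1+i | _
  rewrite δ-≡ j≡1+i | δ-≢ {toℕ i} {suc (toℕ j)} (λ i≡1+j → m≢1+n+m (toℕ j) {1} (trans j≡1+i (cong suc i≡1+j)))
  = refl
... | no j≢1+i  | yes i≡1+j rewrite δ-≢ j≢1+i | δ-≡ i≡1+j = refl
... | no j≢1+i  | no i≢1+j  rewrite δ-≢ j≢1+i | δ-≢ i≢1+j = refl

sum-tabulate-+ : ∀ {n} (f g : Fin n → ℕ) → V.sum (tabulate (λ j → f j + g j)) ≡ V.sum (tabulate f) + V.sum (tabulate g)
sum-tabulate-+ {zero}  f g = refl
sum-tabulate-+ {suc n} f g =
  trans (cong (f zero + g zero +_) (sum-tabulate-+ (f ∘ suc) (g ∘ suc))) (+-interchange (f zero) (g zero) _ _)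
  where
  +-interchange : ∀ p q s t → (p + q) + (s + t) ≡ (p + s) + (q + t)
  +-interchange = solve-∀

sum-tabulate-cong : ∀ {n} {f g : Fin n → ℕ} → (∀ j → f j ≡ g j) → V.sum (tabulate f) ≡ V.sum (tabulate g)
sum-tabulate-cong f≗g = cong V.sum (tabulate-cong f≗g)

sum-tabulate-0 : ∀ n → V.sum (tabulate {n = n} (λ _ → 0)) ≡ 0
sum-tabulate-0 zero    = refl
sum-tabulate-0 (suc n) = sum-tabulate-0 n

sum-δ : ∀ {n} (r : Vec ℕ n) m → V.sum (tabulate (λ j → δ (toℕ j) m * lookup r j)) ≡ at (toList r) m
sum-δ []            m       = refl
sum-δ {suc n} (x ∷ r) zero  = trans (cong₂ _+_ (+-identityʳ x) (sum-tabulate-0 n)) (+-identityʳ x)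
sum-δ (x ∷ r)       (suc m) = sum-δ r m

sum-δ-suc : ∀ {n} (r : Vec ℕ n) m → V.sum (tabulate (λ j → δ m (suc (toℕ j)) * lookup r j)) ≡ at (0 ∷ toList r) m
sum-δ-suc []              zero          = refl
sum-δ-suc []              (suc m)       = refl
sum-δ-suc {suc n} (x ∷ r) zero          = sum-tabulate-0 n
sum-δ-suc {suc n} (x ∷ r) (suc zero)    = trans (cong (x + 0 +_) (sum-tabulate-0 n)) (trans (+-identityʳ _) (+-identityʳ x))
sum-δ-suc (x ∷ r)         (suc (suc m)) = sum-δ-suc r (suc m)

-- (A r)(i) = r(i-1) + r(i+1), where `at` reads the missing neighbours of the end vertices as 0.
adjApply-at : ∀ n (r : Vec ℕ n) (i : Fin n) → adjApply n r i ≡ at (0 ∷ toList r) (toℕ i) + at (toList r) (suc (toℕ i))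
adjApply-at n r i = begin
  V.sum (tabulate (λ j → adjP n i j * lookup r j))        ≡⟨ sum-tabulate-cong split-δ ⟩
  V.sum (tabulate (λ j → below j + above j))              ≡⟨ sum-tabulate-+ below above ⟩
  V.sum (tabulate below) + V.sum (tabulate above)         ≡⟨ +-comm (V.sum (tabulate below)) _ ⟩
  V.sum (tabulate above) + V.sum (tabulate below)         ≡⟨ cong₂ _+_ (sum-δ-suc r (toℕ i)) (sum-δ r (suc (toℕ i))) ⟩
  at (0 ∷ toList r) (toℕ i) + at (toList r) (suc (toℕ i)) ∎
  where
  open ≡-Reasoning
  below above : Fin n → ℕ
  below j = δ (toℕ j) (suc (toℕ i)) * lookup r j
  above j = δ (toℕ i) (suc (toℕ j)) * lookup r j
  split-δ : ∀ j → adjP n i j * lookup r j ≡ below j + above j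
  split-δ j = trans (cong (_* lookup r j) (adjP-δ n i j))
                    (*-distribʳ-+ (lookup r j) (δ (toℕ j) (suc (toℕ i))) (δ (toℕ i) (suc (toℕ j))))

lookup-toList : ∀ {n} (w : Vec ℕ n) i → lookup w i ≡ at (toList w) (toℕ i)
lookup-toList (x ∷ w) zero    = refl
lookup-toList (x ∷ w) (suc i) = lookup-toList w i

-- Pads with zeros or truncates to length n.
toVec : (n : ℕ) → List ℕ → Vec ℕ n
toVec n d = tabulate (λ j → at d (toℕ j))

lookup-toVec : ∀ n d i → lookup (toVec n d) i ≡ at d (toℕ i)
lookup-toVec n d i = lookup∘tabulate _ i

toList-toVec : ∀ n d → length d ≡ n → toList (toVec n d) ≡ d
toList-toVec zero    []       _   = refl
toList-toVec (suc n) (x ∷ d) len = cong (x ∷_) (toList-toVec n d (suc-injective len))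

toVec-toList : ∀ {n} (w : Vec ℕ n) → toVec n (toList w) ≡ w
toVec-toList w = trans (tabulate-cong (λ j → sym (lookup-toList w j))) (tabulate∘lookup w)

gcdVec-greatest : ∀ {n g} (r : Vec ℕ n) → (∀ j → g ∣ lookup r j) → g ∣ gcdVec r
gcdVec-greatest []      _   = _ ∣0
gcdVec-greatest (x ∷ r) g∣r = gcd-greatest (g∣r zero) (gcdVec-greatest r (g∣r ∘ suc))

-- Primitivity forces r(1) = 1, and then r(n) = 1 because it divides r(1) along the reversed chain.
IsArithD⇒Arith : ∀ n (w : Vec ℕ n) → IsArithD n w → Arith (toList w)
IsArithD⇒Arith n w (r , _ , _ , gcd≡1 , eqs) = normalise (equations-chain D ρ 0 lengths equations)
  where
  D = toList w
  ρ = toList r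
  lengths : length ρ ≡ length D
  lengths = trans (length-toList r) (sym (length-toList w))
  equations : ∀ j → j < length D → at D j * at ρ j ≡ at (0 ∷ ρ) j + at ρ (suc j)
  equations j j<n = subst (λ t → at D t * at ρ t ≡ at (0 ∷ ρ) t + at ρ (suc t)) (toℕ-fromℕ< j<n')
    (trans (sym (cong₂ _*_ (lookup-toList w i) (lookup-toList r i))) (trans (eqs i) (adjApply-at n r i)))
    where
    j<n' = subst (j <_) (length-toList w) j<n
    i = fromℕ< j<n'
  normalise : (∃ λ y → Chain 0 (at ρ 0) D y 0 × values 0 (at ρ 0) D ≡ ρ) → Arith D
  normalise (y , ch , values≡) = chain-cast refl r₁≡1 y≡1 refl ch
    where
    r₁∣r : ∀ j → at ρ 0 ∣ lookup r j
    r₁∣r j = subst (at ρ 0 ∣_) (sym (lookup-toList r j))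
               (subst (λ t → at ρ 0 ∣ at t (toℕ j)) values≡ (proj₁ (chain-divides ch (_ ∣0) ∣-refl) (toℕ j)))
    r₁≡1 : at ρ 0 ≡ 1
    r₁≡1 = ∣1⇒≡1 (subst (at ρ 0 ∣_) gcd≡1 (gcdVec-greatest r r₁∣r))
    y≡1 : y ≡ 1
    y≡1 = ∣1⇒≡1 (subst (y ∣_) r₁≡1 (proj₂ (chain-divides (chain-reverse ch) (y ∣0) ∣-refl)))

Arith⇒IsArithD : ∀ n (w : Vec ℕ n) → 2 ≤ n → Arith (toList w) → IsArithD n w
Arith⇒IsArithD (suc n) w@(_ ∷ _) n≥2 s = r , d-positive , r-positive , gcd-zeroˡ (gcdVec (V.tail r)) , eqs
  where
  D = toList w
  ρ = values 0 1 D
  length-D : length D ≡ suc n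
  length-D = length-toList w
  length-ρ : length ρ ≡ suc n
  length-ρ = trans (length-values 0 1 D) length-D
  r : Vec ℕ (suc n)
  r = toVec (suc n) ρ
  index< : ∀ (xs : List ℕ) → length xs ≡ suc n → (i : Fin (suc n)) → toℕ i < length xs
  index< xs len i = subst (toℕ i <_) (sym len) (toℕ<n i)
  d-positive : ∀ i → 1 ≤ lookup w i
  d-positive i = subst (1 ≤_) (sym (lookup-toList w i))
    (arith-entries-positive s (subst (2 ≤_) (sym length-D) n≥2) (toℕ i) (index< D length-D i))
  r-positive : ∀ i → 1 ≤ lookup r i
  r-positive i = subst (1 ≤_) (sym (lookup-toVec (suc n) ρ i))
    (All-at (values-positive s (λ { (() , _) })) (index< ρ length-ρ i))
  eqs : ∀ i → lookup w i * lookup r i ≡ adjApply (suc n) r i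
  eqs i = begin
    lookup w i * lookup r i                                 ≡⟨ cong₂ _*_ (lookup-toList w i) (lookup-toVec (suc n) ρ i) ⟩
    at D (toℕ i) * at ρ (toℕ i)                             ≡⟨ chain-equations s (toℕ i) (index< D length-D i) ⟩
    at (0 ∷ ρ) (toℕ i) + at ρ (suc (toℕ i))                 ≡⟨ cong (λ t → at (0 ∷ t) (toℕ i) + at t (suc (toℕ i)))
                                                                  (sym (toList-toVec (suc n) ρ length-ρ)) ⟩
    at (0 ∷ toList r) (toℕ i) + at (toList r) (suc (toℕ i)) ≡⟨ sym (adjApply-at (suc n) r i) ⟩
    adjApply (suc n) r i                                    ∎
    where open ≡-Reasoning

-- The structure d, rotated so that its extra vertex lands at position i.
rotatedTo : (n : ℕ) → Fin n → List ℕ → Vec ℕ n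
rotatedTo n i d = toVec n (rotate^ (n ∸ toℕ i) d)

toList-rotatedTo : ∀ n i {d} → length d ≡ n → toList (rotatedTo n i d) ≡ rotate^ (n ∸ toℕ i) d
toList-rotatedTo n i {d} len = toList-toVec n _ (trans (length-rotate^ (n ∸ toℕ i) d) len)

lookup-rotatedTo : ∀ n i {d} → length d ≡ n → lookup (rotatedTo n i d) i ≡ closing d
lookup-rotatedTo n i {d} len = begin
  lookup (rotatedTo n i d) i                ≡⟨ lookup-toVec n (rotate^ (n ∸ toℕ i) d) i ⟩
  at (rotate^ (n ∸ toℕ i) d) (toℕ i)        ≡⟨ cong (λ m → at (rotate^ (m ∸ toℕ i) d) (toℕ i)) (sym len) ⟩
  at (rotate^ (length d ∸ toℕ i) d) (toℕ i) ≡⟨ at-rotate^-closing d (subst (toℕ i <_) (sym len) (toℕ<n i)) ⟩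
  closing d                                 ∎
  where open ≡-Reasoning

rotatedTo-injective : ∀ n i {d₁ d₂} → Arith d₁ → Arith d₂ → length d₁ ≡ n → length d₂ ≡ n →
                      rotatedTo n i d₁ ≡ rotatedTo n i d₂ → d₁ ≡ d₂
rotatedTo-injective n i {d₁} {d₂} s₁ s₂ len₁ len₂ eq = begin
  d₁                         ≡⟨ sym (unrotate^-rotate^ t s₁) ⟩
  unrotate^ t (rotate^ t d₁) ≡⟨ cong (unrotate^ t) (trans (sym (toList-rotatedTo n i len₁))
                                                          (trans (cong toList eq) (toList-rotatedTo n i len₂))) ⟩
  unrotate^ t (rotate^ t d₂) ≡⟨ unrotate^-rotate^ t s₂ ⟩
  d₂                         ∎
  where
  open ≡-Reasoning
  t = n ∸ toℕ i

rotatedTo-IsArithD : ∀ n i {d} → 2 ≤ n → Arith d → length d ≡ n → IsArithD n (rotatedTo n i d)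
rotatedTo-IsArithD n i n≥2 s len =
  Arith⇒IsArithD n _ n≥2 (subst Arith (sym (toList-rotatedTo n i len)) (arith-rotate^ (n ∸ toℕ i) s))

rotatedTo-surjective : ∀ n i {w} → IsArithD n w →
                       ∃ λ d → Arith d × length d ≡ n × closing d ≡ lookup w i × rotatedTo n i d ≡ w
rotatedTo-surjective n i {w} arith-w = d , s , len , closing-d , rotated-d
  where
  open ≡-Reasoning
  t = n ∸ toℕ i
  d = unrotate^ t (toList w)
  s : Arith d
  s = arith-unrotate^ t (IsArithD⇒Arith n w arith-w)
  rotate^-d : rotate^ t d ≡ toList w
  rotate^-d = rotate^-unrotate^ t (IsArithD⇒Arith n w arith-w)
  len : length d ≡ n
  len = trans (sym (length-rotate^ t d)) (trans (cong length rotate^-d) (length-toList w))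
  rotated-d : rotatedTo n i d ≡ w
  rotated-d = trans (cong (toVec n) rotate^-d) (toVec-toList w)
  closing-d : closing d ≡ lookup w i
  closing-d = trans (sym (lookup-rotatedTo n i len)) (cong (λ v → lookup v i) rotated-d)

enumeration : (n : ℕ) → Fin n → ℕ → List (Vec ℕ n)
enumeration n i v = map (rotatedTo n i ∘ proj₁) (structures n v)

unique-enumeration : ∀ n i v → Unique (enumeration n i v)
unique-enumeration n i v =
  unique-map-reflect proj₁ (rotatedTo n i ∘ proj₁) (λ c → length (proj₁ c) ≡ n) (structures n v)
                     (All.tabulate (λ c∈ → proj₁ (structures-sound n v c∈)))
                     (λ {c₁} {c₂} len₁ len₂ → rotatedTo-injective n i (proj₂ c₁) (proj₂ c₂) len₁ len₂)
                     (structures-unique n v)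

∈-enumeration : ∀ n i v w → 2 ≤ n → (w ∈ enumeration n i v) ⇔ (IsArithD n w × lookup w i ≡ v)
∈-enumeration n i v w n≥2 = mk⇔ to from
  where
  to : w ∈ enumeration n i v → IsArithD n w × lookup w i ≡ v
  to w∈ with ∈-map⁻ (rotatedTo n i ∘ proj₁) w∈
  ... | (d , s) , c∈ , refl with structures-sound n v c∈
  ...   | len , closing-d = rotatedTo-IsArithD n i n≥2 s len , trans (lookup-rotatedTo n i len) closing-d
  from : IsArithD n w × lookup w i ≡ v → w ∈ enumeration n i v
  from (arith-w , w-i≡v) with rotatedTo-surjective n i {w} arith-w
  ... | d , s , len , closing-d , rotated≡w with structures-complete n v s len (trans closing-d w-i≡v)
  ...   | c , c∈ , refl = subst (_∈ enumeration n i v) rotated≡w (∈-map⁺ (rotatedTo n i ∘ proj₁) c∈)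

theorem2p17 : (n : ℕ) → 2 ≤ n → (i : Fin n) → (k : ℕ) → k ≤ n ∸ 2 →
    Σ (List (Vec ℕ n)) (λ L →
    Unique L ×
    ((d : Vec ℕ n) → (d ∈ L) ⇔ (IsArithD n d × lookup d i ≡ n ∸ k ∸ 1)) ×
    (length L ≡ ballot (n ∸ 2) k))
theorem2p17 (suc zero)    (s≤s ())
theorem2p17 (suc (suc m)) n≥2 i k k≤m =
  enumeration n i v , unique-enumeration n i v , membership ,
  trans (length-map _ (structures n v)) (length-structures m (m ∸ k) k (m∸n+n≡m k≤m))
  where
  n = suc (suc m)
  v = suc (m ∸ k)
  membership : (d : Vec ℕ n) → (d ∈ enumeration n i v) ⇔ (IsArithD n d × lookup d i ≡ n ∸ k ∸ 1)
  membership d rewrite cong (_∸ 1) (+-∸-assoc 2 k≤m) = ∈-enumeration n i v d n≥2
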